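{- Let $s_{n,d}$ be the number of $d$-dimensional cubes in the state complex of the robot $SR_n$. Then \[\sum_{n,d\ge0} s_{n,d}\,x^ny^d=\frac{1+x+xy+x^2y}{1-x-x^2-x^3y}.\]
   Context: The robotic arm $SR_n$: $n$ unit links in the strip $[0,n]\times[0,1]$, base at $(0,0)$, each facing north, south or east, never revisiting a point; states correspond to spread-out subsets $A\subseteq[n]$ (indices of vertical links, no two consecutive). Moves: corner switch at $i$ ($1\le i\le n-1$): links $i,i+1$ facing different directions interchange directions if the result is valid (changes links $\{i,i+1\}$, involves links $\{i-1,i,i+1,i+2\}\cap[n]$); end flip: last link rotates $90^\circ$ between horizontal and vertical if the result is valid (changes $\{n\}$, involves $\{n-1,n\}\cap[n]$). Two moves commute if the links changed by each are disjoint from the links involved in the other. The state complex has the states as vertices and, for each state $u$ and each set of $d$ pairwise commuting moves applicable at $u$, a $d$-cube whose vertices are the $2^d$ states obtained by applying subsets of these moves to $u$. For $n=0$ the convention is that there is a single state and no moves, so $s_{0,0}=1$ and $s_{0,d}=0$ for $d>0$. -}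

module Defs where

open import Data.Bool using (Bool; true; false; _∧_; _∨_; not; if_then_else_)
open import Data.Nat as ℕ using (ℕ; zero; suc; _+_; _∸_; _≡ᵇ_; _<ᵇ_)
open import Data.Integer as ℤ using (ℤ; +_; -[1+_])
open import Data.List using (List; []; _∷_; map; length; filter; concatMap;
  upTo; scanl; foldr; deduplicateᵇ; _++_)
open import Data.Bool.ListAction using (all; any)
open import Data.Product using (_×_; _,_; proj₁; proj₂)

data Dir : Set where
  N S E : Dir

_≡ᵈ_ : Dir → Dir → Bool
N ≡ᵈ N = true
S ≡ᵈ S = true
E ≡ᵈ E = true
_ ≡ᵈ _ = false

-- a configuration of SR_n: the list of directions of links 1..n
Config : Set
Config = List Dir

words : ℕ → List Config
words zero    = [] ∷ []
words (suc n) = concatMap (λ w → (N ∷ w) ∷ (S ∷ w) ∷ (E ∷ w) ∷ []) (words n)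

Point : Set
Point = ℕ × ℤ

step : Point → Dir → Point
step (x , y) N = (x , y ℤ.+ + 1)
step (x , y) S = (x , y ℤ.- + 1)
step (x , y) E = (suc x , y)

points : Config → List Point
points = scanl step (0 , + 0)

_≡ᵖ_ : Point → Point → Bool
(x , y) ≡ᵖ (x' , y') = (x ≡ᵇ x') ∧ (ℤ.∣ y ℤ.- y' ∣ ≡ᵇ 0)

inStrip : ℕ → Point → Bool
inStrip n (x , + 0) = x ℕ.≤ᵇ n
inStrip n (x , + 1) = x ℕ.≤ᵇ n
inStrip n (x , _)   = false

distinct : List Point → Bool
distinct []       = true
distinct (p ∷ ps) = not (any (p ≡ᵖ_) ps) ∧ distinct ps

valid : ℕ → Config → Bool
valid n c = (length c ≡ᵇ n) ∧ all (inStrip n) (points c) ∧ distinct (points c)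

states : ℕ → List Config
states n = filter (λ c → Data.Bool.T? (valid n c)) (words n)
  where import Data.Bool

data Move : Set where
  corner : ℕ → Move     -- corner switch at i, 1 ≤ i ≤ n-1
  flip   : Move

moves : ℕ → List Move
moves zero    = []
moves (suc m) = map (λ k → corner (suc k)) (upTo m) ++ (flip ∷ [])

-- direction of link i (1-based)
dirAt : ℕ → Config → Dir
dirAt i c = go i c
  where
  go : ℕ → Config → Dir
  go _ []                = E
  go zero (d ∷ _)        = d      -- not used (links are 1-based)
  go (suc zero) (d ∷ _)  = d
  go (suc (suc k)) (_ ∷ ds) = go (suc k) ds

swapAt : ℕ → Config → Config
swapAt _ []               = []
swapAt _ (d ∷ [])         = d ∷ []
swapAt zero c             = c
swapAt (suc zero) (a ∷ b ∷ ds) = b ∷ a ∷ ds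
swapAt (suc (suc k)) (a ∷ ds)  = a ∷ swapAt (suc k) ds

-- rotate the last link by 90°: a vertical link becomes horizontal; a
-- horizontal one becomes vertical, pointing towards the other side of
-- the strip (the opposite rotation would leave the strip [0,n]×[0,1])
rotLast : Config → Config
rotLast c = go (+ 0) c
  where
  go : ℤ → Config → Config
  go y []            = []
  go y (N ∷ [])      = E ∷ []
  go y (S ∷ [])      = E ∷ []
  go (+ 0) (E ∷ [])  = N ∷ []
  go y (E ∷ [])      = S ∷ []
  go y (d ∷ d' ∷ ds) = d ∷ go (proj₂ (step (0 , y) d)) (d' ∷ ds)

apply : Move → Config → Config
apply (corner i) c = swapAt i c
apply flip       c = rotLast c

applicable : ℕ → Move → Config → Bool
applicable n (corner i) c = not (dirAt i c ≡ᵈ dirAt (suc i) c) ∧ valid n (swapAt i c)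
applicable n flip       c = valid n (rotLast c)

inRange : ℕ → ℕ → Bool
inRange n k = (1 ℕ.≤ᵇ k) ∧ (k ℕ.≤ᵇ n)

changed : ℕ → Move → List ℕ
changed n (corner i) = i ∷ suc i ∷ []
changed n flip       = n ∷ []

involved : ℕ → Move → List ℕ
involved n (corner i) = filter (λ k → Data.Bool.T? (inRange n k)) ((i ∸ 1) ∷ i ∷ suc i ∷ suc (suc i) ∷ [])
  where import Data.Bool
involved n flip       = filter (λ k → Data.Bool.T? (inRange n k)) ((n ∸ 1) ∷ n ∷ [])
  where import Data.Bool

disjoint : List ℕ → List ℕ → Bool
disjoint xs ys = all (λ x → not (any (x ≡ᵇ_) ys)) xs

commute : ℕ → Move → Move → Bool
commute n m m' = disjoint (changed n m) (involved n m') ∧ disjoint (changed n m') (involved n m)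

pairwiseCommute : ℕ → List Move → Bool
pairwiseCommute n []       = true
pairwiseCommute n (m ∷ ms) = all (commute n m) ms ∧ pairwiseCommute n ms

-- all sublists (subsets, the list having no repetitions)
subsets : {A : Set} → List A → List (List A)
subsets []       = [] ∷ []
subsets (x ∷ xs) = subsets xs ++ map (x ∷_) (subsets xs)

applyAll : List Move → Config → Config
applyAll ms c = foldr apply c ms

-- Cubes of the state complex, identified by their vertex sets

_≡ᶜ_ : Config → Config → Bool
[] ≡ᶜ [] = true
(a ∷ as) ≡ᶜ (b ∷ bs) = (a ≡ᵈ b) ∧ (as ≡ᶜ bs)
_ ≡ᶜ _ = false

_⊆ᵇ_ : List Config → List Config → Bool
xs ⊆ᵇ ys = all (λ x → any (x ≡ᶜ_) ys) xs

sameSet : List Config → List Config → Bool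
sameSet xs ys = (xs ⊆ᵇ ys) ∧ (ys ⊆ᵇ xs)

cubeVertices : List Move → Config → List Config
cubeVertices ms u = map (λ T → applyAll T u) (subsets ms)

-- all d-cubes (as vertex sets, with repetitions) obtained from some state u
-- and some set of d pairwise commuting moves applicable at u
cubesWithRep : ℕ → ℕ → List (List Config)
cubesWithRep n d =
  concatMap (λ u →
    map (λ ms → cubeVertices ms u)
      (filter (λ ms → Data.Bool.T? ((length ms ≡ᵇ d) ∧ pairwiseCommute n ms))
        (subsets (filter (λ m → Data.Bool.T? (applicable n m u)) (moves n)))))
    (states n)
  where import Data.Bool

s : ℕ → ℕ → ℕ
s n d = length (deduplicateᵇ sameSet (cubesWithRep n d))

FPS : Set
FPS = ℕ → ℕ → ℤ   -- f n d = coefficient of x^n y^d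

sumTo : ℕ → (ℕ → ℤ) → ℤ
sumTo zero    f = f 0
sumTo (suc n) f = sumTo n f ℤ.+ f (suc n)

_⊛_ : FPS → FPS → FPS
(f ⊛ g) n d = sumTo n (λ i → sumTo d (λ j → f i j ℤ.* g (n ∸ i) (d ∸ j)))

Sgf : FPS
Sgf n d = + (s n d)

-- numerator 1 + x + xy + x²y
numer : FPS
numer 0 0 = + 1
numer 1 0 = + 1
numer 1 1 = + 1
numer 2 1 = + 1
numer _ _ = + 0

-- denominator 1 - x - x² - x³y
denom : FPS
denom 0 0 = + 1
denom 1 0 = ℤ.- + 1
denom 2 0 = ℤ.- + 1
denom 3 1 = ℤ.- + 1
denom _ _ = + 0

-- A state of SR_n is a word in N, S, E whose vertical links alternate N, S and are never
-- adjacent. A cube is coded by one token per link: H or V for a link that stays horizontal or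
-- vertical, C₁ C₂ for the two links of a corner switch and F for a flipped last link; in a
-- well-formed code no V, C₁ C₂ or F follows a vertical link and F comes last. Marking a set of
-- pairwise commuting moves applicable at a state on the word of that state gives the code of the
-- cube they span; conversely every well-formed code is spanned from its base vertex by the moves
-- at its C₁ and F; and a well-formed code is determined by its vertex set. Hence s_{n,d} counts
-- the well-formed codes of length n with d tokens C₁ or F. Splitting off the first block H, V H
-- or C₁ C₂ H gives s_{n+3,d} = s_{n+2,d} + s_{n+1,d} + s_{n,d-1}, the recurrence of the rational
-- function; the rows n ≤ 2 give its numerator.

module Submission where

open import Defs
open import Data.Bool using (Bool; true; false; _∧_; _∨_; not; T)
open import Data.Bool.Properties using (∧-zeroʳ; T-≡; T-∧; T?)
open import Function.Base using (_∘_; _∘₂_)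
open import Function.Bundles using (Equivalence; _⇔_; mk⇔)
open import Function.Construct.Composition using (_⇔-∘_)
open import Function.Construct.Symmetry using (⇔-sym)
open import Data.Empty using (⊥; ⊥-elim)
open import Data.Nat as ℕ using (ℕ; zero; suc; _+_; _∸_; _≤_; _<_; _≡ᵇ_; z≤n; s≤s)
import Data.Nat.Properties as ℕ
open import Data.Nat.Properties using (<⇒≢; >⇒≢)
open import Data.Integer as ℤ using (ℤ; +_)
import Data.Integer.Properties as ℤ
open import Data.Integer.Tactic.RingSolver using (solve-∀)
open import Data.List
  using (List; []; _∷_; length; scanl; map; _++_; head; drop; foldr; filter; upTo; applyUpTo; deduplicateᵇ)
open import Data.List.Relation.Binary.Sublist.Propositional using (_⊆_; []; _∷_; _∷ʳ_)
import Data.List.Relation.Binary.Sublist.Propositional as Sublist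
import Data.List.Relation.Binary.Sublist.Propositional.Properties as Sublistₚ
open import Data.List.Properties using (∷-injective; map-++; map-∘; length-map; length-++; map-applyUpTo; map-upTo; filter-all)
open import Data.Nat.ListAction using (sum)
open import Data.List.Relation.Binary.Disjoint.Propositional using (Disjoint)
open import Data.List.Relation.Unary.Unique.Propositional using (Unique)
import Data.List.Relation.Unary.Unique.Propositional.Properties as Unique
open import Data.List.Relation.Unary.AllPairs as AllPairs using (AllPairs; []; _∷_)
import Data.List.Relation.Unary.AllPairs.Properties as AllPairs
open import Data.List.Relation.Unary.All as All using (All; []; _∷_)
import Data.List.Relation.Unary.All.Properties as All
open import Data.Maybe using (just)
open import Data.Maybe.Properties using (just-injective)
open import Data.Bool.ListAction using (all; any)
open import Data.List.Membership.Propositional using (_∈_; find)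
open import Data.List.Membership.Propositional.Properties
  using (∈-++⁺ˡ; ∈-++⁺ʳ; ∈-++⁻; ∈-map⁺; ∈-map⁻; ∈-upTo⁻; ∈-filter⁺; ∈-filter⁻
        ; ∈-concatMap⁺; ∈-concatMap⁻)
open import Data.List.Relation.Unary.Any as Any using (here; there)
import Data.List.Relation.Unary.Any.Properties as Any
open import Data.Product as Product using (_×_; _,_; proj₁; proj₂; ∃)
open import Data.Sum as Sum using (_⊎_; inj₁; inj₂)
open import Relation.Binary.PropositionalEquality
open import Relation.Nullary using (¬_; ¬?; yes; no)

-- Heights are booleans: false is the line y = 0, true the line y = 1.
height : Bool → ℤ
height false = + 0
height true  = + 1

-- h: the tip of the arm is on the upper line; l: the previous link is vertical.
admissible : Bool → Bool → Config → Bool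
admissible h     l []      = true
admissible h     l (E ∷ c) = admissible h false c
admissible false l (N ∷ c) = not l ∧ admissible true true c
admissible true  l (S ∷ c) = not l ∧ admissible false true c
admissible true  l (N ∷ c) = false
admissible false l (S ∷ c) = false

≡ᵇ-refl : ∀ m → (m ≡ᵇ m) ≡ true
≡ᵇ-refl m = Equivalence.to T-≡ (ℕ.≡⇒≡ᵇ m m refl)

<⇒≢ᵇ : ∀ {m n} → m < n → (m ≡ᵇ n) ≡ false
<⇒≢ᵇ {zero}  {suc n} _         = refl
<⇒≢ᵇ {suc m} {suc n} (s≤s m<n) = <⇒≢ᵇ m<n

unvisited-west : ∀ c {x' y} (p : Point) → proj₁ p < x' → any (p ≡ᵖ_) (scanl step (x' , y) c) ≡ false
unvisited-west c (x , y₀) x<x' = go c x<x'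
  where
  head≢ : ∀ {x' y} rest → x < x' → ((x , y₀) ≡ᵖ (x' , y)) ∨ rest ≡ rest
  head≢ rest x<x' rewrite <⇒≢ᵇ x<x' = refl
  go : ∀ c {x' y} → x < x' → any ((x , y₀) ≡ᵖ_) (scanl step (x' , y) c) ≡ false
  go []      x<x' = head≢ false x<x'
  go (N ∷ c) x<x' = trans (head≢ _ x<x') (go c x<x')
  go (S ∷ c) x<x' = trans (head≢ _ x<x') (go c x<x')
  go (E ∷ c) x<x' = trans (head≢ _ x<x') (go c (ℕ.m≤n⇒m≤1+n x<x'))

inStrip-height : ∀ {n x} h → x ≤ n → inStrip n (x , height h) ≡ true
inStrip-height {n} {x} false x≤n = Equivalence.to T-≡ (ℕ.≤⇒≤ᵇ x≤n)
inStrip-height {n} {x} true  x≤n = Equivalence.to T-≡ (ℕ.≤⇒≤ᵇ x≤n)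

wellPlaced : ℕ → Point → Config → Bool
wellPlaced n p c = all (inStrip n) (scanl step p c) ∧ distinct (scanl step p c)

wellPlaced-∷ : ∀ {n p} d c → inStrip n p ≡ true → any (p ≡ᵖ_) (scanl step (step p d) c) ≡ false →
               wellPlaced n p (d ∷ c) ≡ wellPlaced n (step p d) c
wellPlaced-∷ {n} {p} d c p-in p-new =
  cong₂ (λ a b → (a ∧ all (inStrip n) ps) ∧ (not b ∧ distinct ps)) p-in p-new
  where ps = scanl step (step p d) c

wellPlaced≡admissible : ∀ {n} c h x → x + length c ≤ n → wellPlaced n (x , height h) c ≡ admissible h false c
wellPlaced≡admissible {n} [] h x x≤n rewrite inStrip-height h (ℕ.m+n≤o⇒m≤o x x≤n) = refl
wellPlaced≡admissible {n} (E ∷ c) h x bound =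
  trans (wellPlaced-∷ {n} {x , height h} E c (inStrip-height h (ℕ.m+n≤o⇒m≤o x bound))
          (unvisited-west c (x , height h) (ℕ.n<1+n x)))
        (wellPlaced≡admissible c h (suc x) (subst (_≤ n) (ℕ.+-suc x (length c)) bound))
-- A vertical link leaving the strip breaks inStrip, two opposite vertical links revisit a point.
wellPlaced≡admissible {n} (N ∷ c) true  x _ = cong (_∧ _) (∧-zeroʳ (inStrip n (x , + 1)))
wellPlaced≡admissible {n} (S ∷ c) false x _ = cong (_∧ _) (∧-zeroʳ (inStrip n (x , + 0)))
wellPlaced≡admissible {n} (N ∷ []) false x bound
  rewrite inStrip-height {n} false (ℕ.m+n≤o⇒m≤o x bound) | ∧-zeroʳ (x ≡ᵇ x) = refl
wellPlaced≡admissible {n} (S ∷ []) true x bound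
  rewrite inStrip-height {n} true (ℕ.m+n≤o⇒m≤o x bound) | ∧-zeroʳ (x ≡ᵇ x) = refl
wellPlaced≡admissible {n} (N ∷ E ∷ c) false x bound =
  trans (wellPlaced-∷ {n} {x , + 0} N (E ∷ c) (inStrip-height false (ℕ.m+n≤o⇒m≤o x bound))
          (trans (cong (_∨ any ((x , + 0) ≡ᵖ_) (scanl step (suc x , + 1) c)) (∧-zeroʳ (x ≡ᵇ x)))
                 (unvisited-west c (x , + 0) (ℕ.n<1+n x))))
        (wellPlaced≡admissible (E ∷ c) true x (ℕ.≤-trans (ℕ.+-monoʳ-≤ x (ℕ.n≤1+n _)) bound))
wellPlaced≡admissible {n} (S ∷ E ∷ c) true x bound =
  trans (wellPlaced-∷ {n} {x , + 1} S (E ∷ c) (inStrip-height true (ℕ.m+n≤o⇒m≤o x bound))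
          (trans (cong (_∨ any ((x , + 1) ≡ᵖ_) (scanl step (suc x , + 0) c)) (∧-zeroʳ (x ≡ᵇ x)))
                 (unvisited-west c (x , + 1) (ℕ.n<1+n x))))
        (wellPlaced≡admissible (E ∷ c) false x (ℕ.≤-trans (ℕ.+-monoʳ-≤ x (ℕ.n≤1+n _)) bound))
wellPlaced≡admissible {n} (N ∷ N ∷ c) false x _
  rewrite ∧-zeroʳ (inStrip n (x , + 1)) | ∧-zeroʳ (inStrip n (x , + 0)) = refl
wellPlaced≡admissible {n} (S ∷ S ∷ c) true x _
  rewrite ∧-zeroʳ (inStrip n (x , + 0)) | ∧-zeroʳ (inStrip n (x , + 1)) = refl
wellPlaced≡admissible {n} (N ∷ S ∷ c) false x _ rewrite ≡ᵇ-refl x = ∧-zeroʳ _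
wellPlaced≡admissible {n} (S ∷ N ∷ c) true x _ rewrite ≡ᵇ-refl x = ∧-zeroʳ _

valid≡admissible : ∀ {n} c → length c ≡ n → valid n c ≡ admissible false false c
valid≡admissible c refl rewrite ≡ᵇ-refl (length c) = wellPlaced≡admissible c false 0 ℕ.≤-refl

valid⇒length : ∀ {n} c → T (valid n c) → length c ≡ n
valid⇒length {n} c v = ℕ.≡ᵇ⇒≡ (length c) n (proj₁ (Equivalence.to T-∧ v))

valid⇒admissible : ∀ {n} c → T (valid n c) → T (admissible false false c)
valid⇒admissible c v = subst T (valid≡admissible c (valid⇒length c v)) v

-- A code assigns a token to each link: H and V are links that stay horizontal resp. vertical
-- throughout the cube, C₁ C₂ are two links exchanged by a corner switch, and F is a last link
-- moved by the end flip.
data Token : Set where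
  H V C₁ C₂ F : Token

Code : Set
Code = List Token

weight : Token → ℕ
weight C₁ = 1
weight F  = 1
weight _  = 0

dim : Code → ℕ
dim k = sum (map weight k)

rise : Bool → Dir
rise false = N
rise true  = S

-- Link t h d h': a link with token t may point in direction d from height h, ending at height h'.
data Link : Token → Bool → Dir → Bool → Set where
  hor   : ∀ {h} → Link H h E h
  ver   : ∀ {h} → Link V h (rise h) (not h)
  freeH : ∀ {h} → Link F h E h
  freeV : ∀ {h} → Link F h (rise h) (not h)

-- Vertex h k c: c is a vertex of the cube with code k, for an arm starting at height h.
data Vertex : Bool → Code → Config → Set where
  []       : ∀ {h} → Vertex h [] []
  _∷_      : ∀ {t h d h' k c} → Link t h d h' → Vertex h' k c → Vertex h (t ∷ k) (d ∷ c)
  switchVH : ∀ {h k c} → Vertex (not h) k c → Vertex h (C₁ ∷ C₂ ∷ k) (rise h ∷ E ∷ c)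
  switchHV : ∀ {h k c} → Vertex (not h) k c → Vertex h (C₁ ∷ C₂ ∷ k) (E ∷ rise h ∷ c)

-- WellFormed l k: k codes a cube of a robot arm whose preceding link is vertical iff l.
data WellFormed : Bool → Code → Set where
  []     : ∀ {l} → WellFormed l []
  hor    : ∀ {l k} → WellFormed false k → WellFormed l (H ∷ k)
  ver    : ∀ {k} → WellFormed true k → WellFormed false (V ∷ k)
  switch : ∀ {k} → WellFormed true k → WellFormed false (C₁ ∷ C₂ ∷ k)
  free   : WellFormed false (F ∷ [])

-- codes n d lists the well-formed codes of length n and dimension d, codesᵛ n d those that may
-- follow a vertical link.
freeTails : ℕ → ℕ → List Code
freeTails zero (suc zero) = [] ∷ []
freeTails _    _          = []

mutual
  codes : ℕ → ℕ → List Code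
  codes zero    zero    = [] ∷ []
  codes zero    (suc d) = []
  codes (suc n) d = map (H ∷_) (codes n d) ++ map (V ∷_) (codesᵛ n d)
                    ++ map (F ∷_) (freeTails n d) ++ map (C₁ ∷_) (switchTails n d)

  codesᵛ : ℕ → ℕ → List Code
  codesᵛ zero    d = codes zero d
  codesᵛ (suc n) d = map (H ∷_) (codes n d)

  switchTails : ℕ → ℕ → List Code
  switchTails (suc n) (suc d) = map (C₂ ∷_) (codesᵛ n d)
  switchTails _       _       = []

mutual
  wellFormed⇒∈codes : ∀ {k} → WellFormed false k → k ∈ codes (length k) (dim k)
  wellFormed⇒∈codes []                 = here refl
  wellFormed⇒∈codes (hor w)            = ∈-++⁺ˡ (∈-map⁺ (H ∷_) (wellFormed⇒∈codes w))
  wellFormed⇒∈codes (ver {k} w)        =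
    ∈-++⁺ʳ (map (H ∷_) (codes (length k) (dim k))) (∈-++⁺ˡ (∈-map⁺ (V ∷_) (wellFormed⇒∈codesᵛ w)))
  wellFormed⇒∈codes free               = here refl
  wellFormed⇒∈codes (switch {k} w)     =
    ∈-++⁺ʳ (map (H ∷_) (codes (suc (length k)) (suc (dim k))))
      (∈-++⁺ʳ (map (V ∷_) (codesᵛ (suc (length k)) (suc (dim k))))
        (∈-++⁺ʳ (map (F ∷_) (freeTails (suc (length k)) (suc (dim k))))
          (∈-map⁺ (C₁ ∷_) (∈-map⁺ (C₂ ∷_) (wellFormed⇒∈codesᵛ w)))))

  wellFormed⇒∈codesᵛ : ∀ {k} → WellFormed true k → k ∈ codesᵛ (length k) (dim k)
  wellFormed⇒∈codesᵛ []      = here refl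
  wellFormed⇒∈codesᵛ (hor w) = ∈-map⁺ (H ∷_) (wellFormed⇒∈codes w)

Coded : Bool → ℕ → ℕ → Code → Set
Coded l n d k = WellFormed l k × length k ≡ n × dim k ≡ d

mutual
  ∈codes⇒coded : ∀ n d {k} → k ∈ codes n d → Coded false n d k
  ∈codes⇒coded zero zero (here refl) = [] , refl , refl
  ∈codes⇒coded (suc n) d k∈ with ∈-++⁻ (map (H ∷_) (codes n d)) k∈
  ... | inj₁ k∈H with ∈-map⁻ (H ∷_) k∈H
  ...   | k , k∈ , refl with ∈codes⇒coded n d k∈
  ...     | w , refl , refl = hor w , refl , refl
  ∈codes⇒coded (suc n) d k∈ | inj₂ k∈VFC with ∈-++⁻ (map (V ∷_) (codesᵛ n d)) k∈VFC
  ... | inj₁ k∈V with ∈-map⁻ (V ∷_) k∈V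
  ...   | k , k∈ , refl with ∈codesᵛ⇒coded n d k∈
  ...     | w , refl , refl = ver w , refl , refl
  ∈codes⇒coded (suc n) d k∈ | inj₂ k∈VFC | inj₂ k∈FC with ∈-++⁻ (map (F ∷_) (freeTails n d)) k∈FC
  ∈codes⇒coded (suc zero) (suc zero) k∈ | _ | _ | inj₁ (here refl) = free , refl , refl
  ∈codes⇒coded (suc (suc n)) (suc d) k∈ | _ | _ | inj₂ k∈C with ∈-map⁻ (C₁ ∷_) k∈C
  ... | _ , k∈ , refl with ∈-map⁻ (C₂ ∷_) k∈
  ...   | k , k∈ , refl with ∈codesᵛ⇒coded n d k∈
  ...     | w , refl , refl = switch w , refl , refl

  ∈codesᵛ⇒coded : ∀ n d {k} → k ∈ codesᵛ n d → Coded true n d k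
  ∈codesᵛ⇒coded zero zero (here refl) = [] , refl , refl
  ∈codesᵛ⇒coded (suc n) d k∈ with ∈-map⁻ (H ∷_) k∈
  ... | k , k∈ , refl with ∈codes⇒coded n d k∈
  ...   | w , refl , refl = hor w , refl , refl

head-∈-map-∷ : ∀ {t : Token} {v xs} → v ∈ map (t ∷_) xs → head v ≡ just t
head-∈-map-∷ {t} v∈ with ∈-map⁻ (t ∷_) v∈
... | _ , _ , refl = refl

map-∷-disjoint : ∀ {t t' : Token} {xs ys : List Code} → t ≢ t' → Disjoint (map (t ∷_) xs) (map (t' ∷_) ys)
map-∷-disjoint t≢t' (v∈ , v∈') = t≢t' (just-injective (trans (sym (head-∈-map-∷ v∈)) (head-∈-map-∷ v∈')))

disjoint-++ : ∀ {xs ys zs : List Code} → Disjoint xs ys → Disjoint xs zs → Disjoint xs (ys ++ zs)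
disjoint-++ {ys = ys} xs#ys xs#zs (v∈xs , v∈yzs) with ∈-++⁻ ys v∈yzs
... | inj₁ v∈ys = xs#ys (v∈xs , v∈ys)
... | inj₂ v∈zs = xs#zs (v∈xs , v∈zs)

unique-map-∷ : ∀ {t : Token} {xs : List Code} → Unique xs → Unique (map (t ∷_) xs)
unique-map-∷ = Unique.map⁺ (λ eq → proj₂ (∷-injective eq))

unique-blocks : ∀ {A B C D : List Code} → Unique A → Unique B → Unique C → Unique D →
                Unique (map (H ∷_) A ++ map (V ∷_) B ++ map (F ∷_) C ++ map (C₁ ∷_) D)
unique-blocks {A} {B} {C} {D} uA uB uC uD =
  Unique.++⁺ (unique-map-∷ uA)
    (Unique.++⁺ (unique-map-∷ uB)
      (Unique.++⁺ (unique-map-∷ uC) (unique-map-∷ uD) (map-∷-disjoint λ ()))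
      (disjoint-++ {ys = map (F ∷_) C} (map-∷-disjoint λ ()) (map-∷-disjoint λ ())))
    (disjoint-++ {ys = map (V ∷_) B} (map-∷-disjoint λ ())
      (disjoint-++ {ys = map (F ∷_) C} (map-∷-disjoint λ ()) (map-∷-disjoint λ ())))

unique-freeTails : ∀ n d → Unique (freeTails n d)
unique-freeTails zero    zero          = []
unique-freeTails zero    (suc zero)    = [] ∷ []
unique-freeTails zero    (suc (suc d)) = []
unique-freeTails (suc n) d             = []

mutual
  unique-codes : ∀ n d → Unique (codes n d)
  unique-codes zero    zero    = [] ∷ []
  unique-codes zero    (suc d) = []
  unique-codes (suc n) d =
    unique-blocks (unique-codes n d) (unique-codesᵛ n d) (unique-freeTails n d) (unique-switchTails n d)

  unique-codesᵛ : ∀ n d → Unique (codesᵛ n d)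
  unique-codesᵛ zero    d = unique-codes zero d
  unique-codesᵛ (suc n) d = unique-map-∷ (unique-codes n d)

  unique-switchTails : ∀ n d → Unique (switchTails n d)
  unique-switchTails zero    d       = []
  unique-switchTails (suc n) zero    = []
  unique-switchTails (suc n) (suc d) = unique-map-∷ (unique-codesᵛ n d)

vertex-length : ∀ {h k c} → Vertex h k c → length c ≡ length k
vertex-length []           = refl
vertex-length (_ ∷ v)      = cong suc (vertex-length v)
vertex-length (switchVH v) = cong (suc ∘ suc) (vertex-length v)
vertex-length (switchHV v) = cong (suc ∘ suc) (vertex-length v)

-- the vertex in which every switch and flip is in its first position
base : ∀ {l k} → Bool → WellFormed l k → Config
base h []         = []
base h (hor w)    = E ∷ base h w
base h (ver w)    = rise h ∷ base (not h) w
base h (switch w) = rise h ∷ E ∷ base (not h) w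
base h free       = E ∷ []

vertex-base : ∀ {l k} h (w : WellFormed l k) → Vertex h k (base h w)
vertex-base h []         = []
vertex-base h (hor w)    = hor ∷ vertex-base h w
vertex-base h (ver w)    = ver ∷ vertex-base (not h) w
vertex-base h (switch w) = switchVH (vertex-base (not h) w)
vertex-base h free       = freeH ∷ []

SameVertices : Bool → Code → Code → Set
SameVertices h k k' = ∀ {c} → Vertex h k c ⇔ Vertex h k' c

¬ver-E : ∀ {h k c} → ¬ Vertex h (V ∷ k) (E ∷ c)
¬ver-E {false} (() ∷ _)
¬ver-E {true}  (() ∷ _)

¬hor-rise : ∀ {h k c} → ¬ Vertex h (H ∷ k) (rise h ∷ c)
¬hor-rise {false} (() ∷ _)
¬hor-rise {true}  (() ∷ _)

SameVertices-cancel : ∀ {h h'} (P : Code → Code) (Q : Config → Config) →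
                      (∀ {k c} → Vertex h' k c → Vertex h (P k) (Q c)) →
                      (∀ {k c} → Vertex h (P k) (Q c) → Vertex h' k c) →
                      ∀ {k k'} → SameVertices h (P k) (P k') → SameVertices h' k k'
SameVertices-cancel P Q extend restrict same =
  mk⇔ (restrict ∘ Equivalence.to same ∘ extend) (restrict ∘ Equivalence.from same ∘ extend)

hor⁻¹ : ∀ {h k c} → Vertex h (H ∷ k) (E ∷ c) → Vertex h k c
hor⁻¹ (hor ∷ v) = v

ver⁻¹ : ∀ {h k c} → Vertex h (V ∷ k) (rise h ∷ c) → Vertex (not h) k c
ver⁻¹ (ver ∷ v) = v

switchHV⁻¹ : ∀ {h k c} → Vertex h (C₁ ∷ C₂ ∷ k) (E ∷ rise h ∷ c) → Vertex (not h) k c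
switchHV⁻¹ {false} (switchHV v) = v
switchHV⁻¹ {true}  (switchHV v) = v

SameVertices⇒length≡ : ∀ {l h k k'} → WellFormed l k → SameVertices h k k' → length k ≡ length k'
SameVertices⇒length≡ {h = h} w same =
  trans (sym (vertex-length (vertex-base h w))) (vertex-length (Equivalence.to same (vertex-base h w)))

SameVertices⇒≡ : ∀ {l l' h k k'} → WellFormed l k → WellFormed l' k' → SameVertices h k k' → k ≡ k'
SameVertices⇒≡ w w' same = go w w' same (SameVertices⇒length≡ w same)
  where
  -- the length equality rules out [] against a nonempty code, and a switch against a flip
  go : ∀ {l l' h k k'} → WellFormed l k → WellFormed l' k' → SameVertices h k k' → length k ≡ length k' → k ≡ k'
  go [] [] _ _ = refl
  go (hor w) (hor w') same _ =
    cong (H ∷_) (SameVertices⇒≡ w w' (SameVertices-cancel (H ∷_) (E ∷_) (hor ∷_) hor⁻¹ same))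
  go {h = h} (ver w) (ver w') same _ =
    cong (V ∷_) (SameVertices⇒≡ w w' (SameVertices-cancel (V ∷_) (rise h ∷_) (ver ∷_) ver⁻¹ same))
  go {h = h} (switch w) (switch w') same _ =
    cong (λ k → C₁ ∷ C₂ ∷ k)
      (SameVertices⇒≡ w w'
        (SameVertices-cancel (λ k → C₁ ∷ C₂ ∷ k) (λ c → E ∷ rise h ∷ c) switchHV switchHV⁻¹ same))
  go free free _ _ = refl
  go {h = h} w@(hor _) (ver _) same _ = ⊥-elim (¬ver-E (Equivalence.to same (vertex-base h w)))
  go {h = h} (ver _) w'@(hor _) same _ = ⊥-elim (¬ver-E (Equivalence.from same (vertex-base h w')))
  go {h = h} (hor w) (switch w') same _ = ⊥-elim (¬hor-rise (Equivalence.from same (vertex-base h (switch w'))))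
  go {h = h} (switch w) (hor w') same _ = ⊥-elim (¬hor-rise (Equivalence.to same (vertex-base h (switch w))))
  go (hor w) free same _ = ⊥-elim (¬hor-rise (Equivalence.from same (freeV ∷ [])))
  go free (hor w') same _ = ⊥-elim (¬hor-rise (Equivalence.to same (freeV ∷ [])))
  go {h = h} (ver w) (switch w') same _ = ⊥-elim (¬ver-E (Equivalence.from same (switchHV (vertex-base (not h) w'))))
  go {h = h} (switch w) (ver w') same _ = ⊥-elim (¬ver-E (Equivalence.to same (switchHV (vertex-base (not h) w))))
  go (ver w) free same _ = ⊥-elim (¬ver-E (Equivalence.from same (freeH ∷ [])))
  go free (ver w') same _ = ⊥-elim (¬ver-E (Equivalence.to same (freeH ∷ [])))

-- Links are numbered from 1; position 0 and positions past the end read as H.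
tokenAt : ℕ → Code → Token
tokenAt zero          _       = H
tokenAt (suc i)       []      = H
tokenAt (suc zero)    (t ∷ _) = t
tokenAt (suc (suc i)) (_ ∷ k) = tokenAt (suc i) k

markSwitch : ℕ → Code → Code
markSwitch zero          k           = k
markSwitch (suc zero)    (a ∷ b ∷ k) = C₁ ∷ C₂ ∷ k
markSwitch (suc zero)    k           = k
markSwitch (suc (suc i)) []          = []
markSwitch (suc (suc i)) (a ∷ k)     = a ∷ markSwitch (suc i) k

markFree : Code → Code
markFree []           = []
markFree (t ∷ [])     = F ∷ []
markFree (t ∷ t' ∷ k) = t ∷ markFree (t' ∷ k)

data Switchable : Token → Token → Set where
  VH : Switchable V H
  HV : Switchable H V

data Fixed : Token → Set where
  H : Fixed H
  V : Fixed V

length-markSwitch : ∀ i k → length (markSwitch i k) ≡ length k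
length-markSwitch zero          k           = refl
length-markSwitch (suc zero)    []          = refl
length-markSwitch (suc zero)    (a ∷ [])    = refl
length-markSwitch (suc zero)    (a ∷ b ∷ k) = refl
length-markSwitch (suc (suc i)) []          = refl
length-markSwitch (suc (suc i)) (a ∷ k)     = cong suc (length-markSwitch (suc i) k)

length-markFree : ∀ k → length (markFree k) ≡ length k
length-markFree []           = refl
length-markFree (t ∷ [])     = refl
length-markFree (t ∷ t' ∷ k) = cong suc (length-markFree (t' ∷ k))

tokenAt-markSwitch : ∀ i k {p} → p ≢ suc i → p ≢ suc (suc i) → tokenAt p (markSwitch (suc i) k) ≡ tokenAt p k
tokenAt-markSwitch i k {zero} _ _ = refl
tokenAt-markSwitch zero [] {suc p} _ _ = refl
tokenAt-markSwitch zero (a ∷ []) {suc p} _ _ = refl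
tokenAt-markSwitch zero (a ∷ b ∷ k) {suc zero} p≢1 _ = ⊥-elim (p≢1 refl)
tokenAt-markSwitch zero (a ∷ b ∷ k) {suc (suc zero)} _ p≢2 = ⊥-elim (p≢2 refl)
tokenAt-markSwitch zero (a ∷ b ∷ k) {suc (suc (suc p))} _ _ = refl
tokenAt-markSwitch (suc i) [] {suc p} _ _ = refl
tokenAt-markSwitch (suc i) (a ∷ k) {suc zero} _ _ = refl
tokenAt-markSwitch (suc i) (a ∷ k) {suc (suc p)} p≢ p≢′ =
  tokenAt-markSwitch i k {suc p} (p≢ ∘ cong suc) (p≢′ ∘ cong suc)

tokenAt-markFree : ∀ k {p} → p ≢ length k → tokenAt p (markFree k) ≡ tokenAt p k
tokenAt-markFree k {zero} _ = refl
tokenAt-markFree [] {suc p} _ = refl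
tokenAt-markFree (t ∷ []) {suc zero} p≢ = ⊥-elim (p≢ refl)
tokenAt-markFree (t ∷ []) {suc (suc p)} _ = refl
tokenAt-markFree (t ∷ t' ∷ k) {suc zero} _ = refl
tokenAt-markFree (t ∷ t' ∷ k) {suc (suc p)} p≢ = tokenAt-markFree (t' ∷ k) {suc p} (p≢ ∘ cong suc)

dim-markSwitch : ∀ i {k} → Switchable (tokenAt (suc i) k) (tokenAt (suc (suc i)) k) → suc (suc i) ≤ length k →
                 dim (markSwitch (suc i) k) ≡ suc (dim k)
dim-markSwitch zero    {V ∷ H ∷ k} VH _ = refl
dim-markSwitch zero    {H ∷ V ∷ k} HV _ = refl
dim-markSwitch zero    {V ∷ []}    VH (s≤s ())
dim-markSwitch (suc i) {t ∷ k} sw (s≤s len) =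
  trans (cong (_+_ (weight t)) (dim-markSwitch i sw len)) (ℕ.+-suc (weight t) (dim k))

dim-markFree : ∀ {m} k → length k ≡ suc m → Fixed (tokenAt (suc m) k) → dim (markFree k) ≡ suc (dim k)
dim-markFree (H ∷ [])     refl _   = refl
dim-markFree (V ∷ [])     refl _   = refl
dim-markFree (t ∷ t' ∷ k) refl fix =
  trans (cong (_+_ (weight t)) (dim-markFree (t' ∷ k) refl fix)) (ℕ.+-suc (weight t) (dim (t' ∷ k)))

-- The link before link j + 1 is horizontal; before link 1 this is the link preceding the code.
HorizontalBefore : ℕ → Bool → Code → Set
HorizontalBefore zero    l k = l ≡ false
HorizontalBefore (suc j) l k = tokenAt (suc j) k ≡ H

wellFormed-afterVertical : ∀ {k} → WellFormed false k → tokenAt 1 k ≡ H → WellFormed true k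
wellFormed-afterVertical []      _ = []
wellFormed-afterVertical (hor w) _ = hor w

wellFormed-markSwitch : ∀ j {l k} → WellFormed l k → Switchable (tokenAt (suc j) k) (tokenAt (suc (suc j)) k) →
                        suc (suc j) ≤ length k → HorizontalBefore j l k → tokenAt (3 + j) k ≡ H →
                        WellFormed l (markSwitch (suc j) k)
wellFormed-markSwitch zero          (ver (hor w))    VH _         _    right = switch (wellFormed-afterVertical w right)
wellFormed-markSwitch zero          (hor (ver w))    HV _         refl _     = switch w
wellFormed-markSwitch zero          (ver [])         VH (s≤s ())  _    _
wellFormed-markSwitch (suc zero)    (hor w)          sw (s≤s len) _    right = hor (wellFormed-markSwitch zero w sw len refl right)
wellFormed-markSwitch (suc (suc j)) (hor w)          sw (s≤s len) left right = hor (wellFormed-markSwitch (suc j) w sw len left right)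
wellFormed-markSwitch (suc (suc j)) (ver w)          sw (s≤s len) left right = ver (wellFormed-markSwitch (suc j) w sw len left right)
wellFormed-markSwitch (suc (suc (suc j))) (switch w) sw (s≤s (s≤s len)) left right =
  switch (wellFormed-markSwitch (suc j) w sw len left right)
wellFormed-markSwitch (suc zero)    (ver w)          _  _         ()   _
wellFormed-markSwitch (suc (suc zero)) (switch w)    _  _         ()   _
wellFormed-markSwitch (suc zero)    (switch w)       () _         _    _
wellFormed-markSwitch (suc j)       []               () _         _    _
wellFormed-markSwitch (suc j)       free             () _         _    _

wellFormed-markFree : ∀ {l m k} → WellFormed l k → length k ≡ suc m → Fixed (tokenAt (suc m) k) →
                      HorizontalBefore m l k → WellFormed l (markFree k)
wellFormed-markFree (hor [])                 refl _   refl = free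
wellFormed-markFree (ver [])                 refl _   _    = free
wellFormed-markFree (hor {k = _ ∷ []} w)     refl fix _    = hor (wellFormed-markFree w refl fix refl)
wellFormed-markFree (hor {k = _ ∷ _ ∷ _} w)  refl fix left = hor (wellFormed-markFree w refl fix left)
wellFormed-markFree (ver {k = _ ∷ _ ∷ _} w)  refl fix left = ver (wellFormed-markFree w refl fix left)
wellFormed-markFree (switch {k = _ ∷ _ ∷ _} w) refl fix left = switch (wellFormed-markFree w refl fix left)
wellFormed-markFree (switch {k = _ ∷ []} w)  refl _   ()
wellFormed-markFree (ver {k = _ ∷ []} w)     refl _   ()
wellFormed-markFree (switch {k = []} w)      refl ()  _
wellFormed-markFree free                     refl ()  _

swapAt-∷ : ∀ j d c → swapAt (suc (suc j)) (d ∷ c) ≡ d ∷ swapAt (suc j) c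
swapAt-∷ j d []      = refl
swapAt-∷ j d (_ ∷ _) = refl

swapAt-involutive : ∀ i c → swapAt i (swapAt i c) ≡ c
swapAt-involutive i             []          = refl
swapAt-involutive i             (d ∷ [])    = refl
swapAt-involutive zero          (a ∷ b ∷ c) = refl
swapAt-involutive (suc zero)    (a ∷ b ∷ c) = refl
swapAt-involutive (suc (suc j)) (a ∷ b ∷ c) =
  trans (swapAt-∷ j a (swapAt (suc j) (b ∷ c))) (cong (a ∷_) (swapAt-involutive (suc j) (b ∷ c)))

link≢C₁ : ∀ {t h d h'} → Link t h d h' → t ≢ C₁
link≢C₁ hor   ()
link≢C₁ ver   ()
link≢C₁ freeH ()
link≢C₁ freeV ()

vertex-markSwitch : ∀ {h} j {k c} → Vertex h k c → Switchable (tokenAt (suc j) k) (tokenAt (suc (suc j)) k) →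
                    Vertex h (markSwitch (suc j) k) c
vertex-markSwitch zero    (ver ∷ [])         VH = ver ∷ []
vertex-markSwitch zero    (ver ∷ hor ∷ v)    VH = switchVH v
vertex-markSwitch zero    (hor ∷ ver ∷ v)    HV = switchHV v
vertex-markSwitch (suc j) (l ∷ v)            sw = l ∷ vertex-markSwitch j v sw
vertex-markSwitch (suc (suc j)) (switchVH v) sw = switchVH (vertex-markSwitch j v sw)
vertex-markSwitch (suc (suc j)) (switchHV v) sw = switchHV (vertex-markSwitch j v sw)

vertex-swapAt : ∀ {h} j {k c} → Vertex h k c → tokenAt (suc j) k ≡ C₁ → tokenAt (suc (suc j)) k ≡ C₂ →
                Vertex h k (swapAt (suc j) c)
vertex-swapAt zero (switchVH v) _ _ = switchHV v
vertex-swapAt zero (switchHV v) _ _ = switchVH v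
vertex-swapAt zero (l ∷ v) t≡C₁ _ = ⊥-elim (link≢C₁ l t≡C₁)
vertex-swapAt (suc j) {c = d ∷ c} (l ∷ v) at₁ at₂ rewrite swapAt-∷ j d c = l ∷ vertex-swapAt j v at₁ at₂
vertex-swapAt {h} (suc (suc j)) {c = _ ∷ _ ∷ c} (switchVH v) at₁ at₂
  rewrite swapAt-∷ (suc j) (rise h) (E ∷ c) | swapAt-∷ j E c = switchVH (vertex-swapAt j v at₁ at₂)
vertex-swapAt {h} (suc (suc j)) {c = _ ∷ _ ∷ c} (switchHV v) at₁ at₂
  rewrite swapAt-∷ (suc j) E (rise h ∷ c) | swapAt-∷ j (rise h) c = switchHV (vertex-swapAt j v at₁ at₂)

tokenAt-markSwitch₁ : ∀ j k → suc (suc j) ≤ length k → tokenAt (suc j) (markSwitch (suc j) k) ≡ C₁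
tokenAt-markSwitch₁ zero    (a ∷ b ∷ k) _         = refl
tokenAt-markSwitch₁ zero    (a ∷ [])    (s≤s ())
tokenAt-markSwitch₁ (suc j) (a ∷ k)     (s≤s len) = tokenAt-markSwitch₁ j k len

tokenAt-markSwitch₂ : ∀ j k → suc (suc j) ≤ length k → tokenAt (suc (suc j)) (markSwitch (suc j) k) ≡ C₂
tokenAt-markSwitch₂ zero    (a ∷ b ∷ k) _         = refl
tokenAt-markSwitch₂ zero    (a ∷ [])    (s≤s ())
tokenAt-markSwitch₂ (suc j) (a ∷ k)     (s≤s len) = tokenAt-markSwitch₂ j k len

vertex-markSwitch-swapAt : ∀ {h} j {k c} → Vertex h k c → Switchable (tokenAt (suc j) k) (tokenAt (suc (suc j)) k) →
                           suc (suc j) ≤ length k → Vertex h (markSwitch (suc j) k) (swapAt (suc j) c)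
vertex-markSwitch-swapAt j {k} v sw len =
  vertex-swapAt j (vertex-markSwitch j v sw) (tokenAt-markSwitch₁ j k len) (tokenAt-markSwitch₂ j k len)

vertex-markSwitch⁻¹ : ∀ {h} j {k c} → Vertex h (markSwitch (suc j) k) c →
                      Switchable (tokenAt (suc j) k) (tokenAt (suc (suc j)) k) →
                      Vertex h k c ⊎ Vertex h k (swapAt (suc j) c)
vertex-markSwitch⁻¹ zero {_ ∷ []}    v            _  = inj₁ v
vertex-markSwitch⁻¹ zero {_ ∷ _ ∷ _} (switchVH v) VH = inj₁ (ver ∷ hor ∷ v)
vertex-markSwitch⁻¹ zero {_ ∷ _ ∷ _} (switchHV v) VH = inj₂ (ver ∷ hor ∷ v)
vertex-markSwitch⁻¹ zero {_ ∷ _ ∷ _} (switchVH v) HV = inj₂ (hor ∷ ver ∷ v)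
vertex-markSwitch⁻¹ zero {_ ∷ _ ∷ _} (switchHV v) HV = inj₁ (hor ∷ ver ∷ v)
vertex-markSwitch⁻¹ (suc j) {H ∷ k} {d ∷ c} (l ∷ v) sw rewrite swapAt-∷ j d c =
  Sum.map (l ∷_) (l ∷_) (vertex-markSwitch⁻¹ j v sw)
vertex-markSwitch⁻¹ (suc j) {V ∷ k} {d ∷ c} (l ∷ v) sw rewrite swapAt-∷ j d c =
  Sum.map (l ∷_) (l ∷_) (vertex-markSwitch⁻¹ j v sw)
vertex-markSwitch⁻¹ (suc j) {F ∷ k} {d ∷ c} (l ∷ v) sw rewrite swapAt-∷ j d c =
  Sum.map (l ∷_) (l ∷_) (vertex-markSwitch⁻¹ j v sw)
vertex-markSwitch⁻¹ {h} (suc (suc j)) {C₁ ∷ C₂ ∷ k} {_ ∷ _ ∷ c} (switchVH v) sw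
  rewrite swapAt-∷ (suc j) (rise h) (E ∷ c) | swapAt-∷ j E c = Sum.map switchVH switchVH (vertex-markSwitch⁻¹ j v sw)
vertex-markSwitch⁻¹ {h} (suc (suc j)) {C₁ ∷ C₂ ∷ k} {_ ∷ _ ∷ c} (switchHV v) sw
  rewrite swapAt-∷ (suc j) E (rise h ∷ c) | swapAt-∷ j (rise h) c = Sum.map switchHV switchHV (vertex-markSwitch⁻¹ j v sw)
vertex-markSwitch⁻¹ (suc j) {C₂ ∷ _} (() ∷ _) _
vertex-markSwitch⁻¹ (suc zero) {C₁ ∷ _ ∷ []}    (() ∷ _)     _
vertex-markSwitch⁻¹ (suc zero) {C₁ ∷ _ ∷ []}    (switchVH _) ()
vertex-markSwitch⁻¹ (suc zero) {C₁ ∷ _ ∷ []}    (switchHV _) ()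
vertex-markSwitch⁻¹ (suc zero) {C₁ ∷ _ ∷ _ ∷ _} (() ∷ _)     _

next : Bool → Dir → Bool
next h E = h
next _ N = true
next _ S = false

next-link : ∀ {t h d h'} → Link t h d h' → next h d ≡ h'
next-link hor                = refl
next-link {h = false} ver    = refl
next-link {h = true}  ver    = refl
next-link freeH              = refl
next-link {h = false} freeV  = refl
next-link {h = true}  freeV  = refl

-- rotLast, with the height tracked as a boolean
flipLast : Bool → Config → Config
flipLast h (d ∷ d' ∷ c) = d ∷ flipLast (next h d) (d' ∷ c)
flipLast h (N ∷ [])     = E ∷ []
flipLast h (S ∷ [])     = E ∷ []
flipLast h (E ∷ [])     = rise h ∷ []
flipLast h []           = []

mutual
  rotLast≡flipLast : ∀ {l} c → T (admissible false l c) → rotLast c ≡ flipLast false c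
  rotLast≡flipLast []          _ = refl
  rotLast≡flipLast (E ∷ [])    _ = refl
  rotLast≡flipLast (N ∷ [])    _ = refl
  rotLast≡flipLast (E ∷ d ∷ c) a = cong (E ∷_) (rotLast≡flipLast (d ∷ c) a)
  rotLast≡flipLast {l} (N ∷ d ∷ c) a =
    cong (N ∷_) (rotLast-above≡flipLast (d ∷ c) (proj₂ (Equivalence.to (T-∧ {not l}) a)))

  rotLast-above≡flipLast : ∀ {l} c → T (admissible true l c) → drop 1 (rotLast (N ∷ c)) ≡ flipLast true c
  rotLast-above≡flipLast []          _ = refl
  rotLast-above≡flipLast (E ∷ [])    _ = refl
  rotLast-above≡flipLast (S ∷ [])    _ = refl
  rotLast-above≡flipLast (E ∷ d ∷ c) a = cong (E ∷_) (rotLast-above≡flipLast (d ∷ c) a)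
  rotLast-above≡flipLast {l} (S ∷ d ∷ c) a =
    cong (S ∷_) (rotLast≡flipLast (d ∷ c) (proj₂ (Equivalence.to (T-∧ {not l}) a)))

flipLast-∷ : ∀ {t h d h'} → Link t h d h' → ∀ x c → flipLast h (d ∷ x ∷ c) ≡ d ∷ flipLast h' (x ∷ c)
flipLast-∷ l x c rewrite next-link l = refl

flipLast-switchVH : ∀ h x c → flipLast h (rise h ∷ E ∷ x ∷ c) ≡ rise h ∷ E ∷ flipLast (not h) (x ∷ c)
flipLast-switchVH h x c = trans (flipLast-∷ ver E (x ∷ c)) (cong (rise h ∷_) (flipLast-∷ hor x c))

flipLast-switchHV : ∀ h x c → flipLast h (E ∷ rise h ∷ x ∷ c) ≡ E ∷ rise h ∷ flipLast (not h) (x ∷ c)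
flipLast-switchHV h x c = cong (E ∷_) (flipLast-∷ ver x c)

freed : ∀ {t h d h'} → Link t h d h' → Link F h d h'
freed hor   = freeH
freed ver   = freeV
freed freeH = freeH
freed freeV = freeV

vertex-markFree : ∀ {h m k c} → Vertex h k c → length k ≡ suc m → Fixed (tokenAt (suc m) k) → Vertex h (markFree k) c
vertex-markFree {k = _ ∷ []}              (l ∷ [])     refl _   = freed l ∷ []
vertex-markFree {k = _ ∷ _ ∷ _}           (l ∷ v)      refl fix = l ∷ vertex-markFree v refl fix
vertex-markFree {k = C₁ ∷ C₂ ∷ _ ∷ _}     (switchVH v) refl fix = switchVH (vertex-markFree v refl fix)
vertex-markFree {k = C₁ ∷ C₂ ∷ _ ∷ _}     (switchHV v) refl fix = switchHV (vertex-markFree v refl fix)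

vertex-flipLast : ∀ {h m k c} → Vertex h k c → length k ≡ suc m → tokenAt (suc m) k ≡ F → Vertex h k (flipLast h c)
vertex-flipLast (freeH ∷ [])                refl _ = freeV ∷ []
vertex-flipLast {false} (freeV ∷ [])        refl _ = freeH ∷ []
vertex-flipLast {true}  (freeV ∷ [])        refl _ = freeH ∷ []
vertex-flipLast {k = _ ∷ _ ∷ _} {_ ∷ x ∷ c} (l ∷ v) refl last
  rewrite flipLast-∷ l x c = l ∷ vertex-flipLast v refl last
vertex-flipLast {h} {k = _ ∷ _ ∷ _ ∷ _} {_ ∷ _ ∷ x ∷ c} (switchVH v) refl last
  rewrite flipLast-switchVH h x c = switchVH (vertex-flipLast v refl last)
vertex-flipLast {h} {k = _ ∷ _ ∷ _ ∷ _} {_ ∷ _ ∷ x ∷ c} (switchHV v) refl last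
  rewrite flipLast-switchHV h x c = switchHV (vertex-flipLast v refl last)

tokenAt-markFree-last : ∀ {m} k → length k ≡ suc m → tokenAt (suc m) (markFree k) ≡ F
tokenAt-markFree-last (t ∷ [])     refl = refl
tokenAt-markFree-last (t ∷ t' ∷ k) refl = tokenAt-markFree-last (t' ∷ k) refl

vertex-markFree-flipLast : ∀ {h m k c} → Vertex h k c → length k ≡ suc m → Fixed (tokenAt (suc m) k) →
                           Vertex h (markFree k) (flipLast h c)
vertex-markFree-flipLast {k = k} v len fix =
  vertex-flipLast (vertex-markFree v len fix) (trans (length-markFree k) len) (tokenAt-markFree-last k len)

flipped-∷ : ∀ {t t' h d h' k c} → Link t h d h' →
            Vertex h' (t' ∷ k) c ⊎ ∃ (λ c' → Vertex h' (t' ∷ k) c' × c ≡ flipLast h' c') →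
            Vertex h (t ∷ t' ∷ k) (d ∷ c) ⊎ ∃ λ c' → Vertex h (t ∷ t' ∷ k) c' × d ∷ c ≡ flipLast h c'
flipped-∷ l (inj₁ v)                     = inj₁ (l ∷ v)
flipped-∷ l (inj₂ (x ∷ c' , v , refl))   = inj₂ (_ , l ∷ v , sym (flipLast-∷ l x c'))

vertex-markFree⁻¹ : ∀ {h m} k {c} → Vertex h (markFree k) c → length k ≡ suc m → Fixed (tokenAt (suc m) k) →
                    Vertex h k c ⊎ ∃ λ c' → Vertex h k c' × c ≡ flipLast h c'
vertex-markFree⁻¹ (H ∷ []) (freeH ∷ [])        refl _ = inj₁ (hor ∷ [])
vertex-markFree⁻¹ (H ∷ []) (freeV ∷ [])        refl _ = inj₂ (_ , hor ∷ [] , refl)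
vertex-markFree⁻¹ {false} (V ∷ []) (freeH ∷ []) refl _ = inj₂ (_ , ver ∷ [] , refl)
vertex-markFree⁻¹ {true}  (V ∷ []) (freeH ∷ []) refl _ = inj₂ (_ , ver ∷ [] , refl)
vertex-markFree⁻¹ (V ∷ []) (freeV ∷ [])        refl _ = inj₁ (ver ∷ [])
vertex-markFree⁻¹ (H ∷ t ∷ k) (l ∷ v) refl fix = flipped-∷ l (vertex-markFree⁻¹ (t ∷ k) v refl fix)
vertex-markFree⁻¹ (V ∷ t ∷ k) (l ∷ v) refl fix = flipped-∷ l (vertex-markFree⁻¹ (t ∷ k) v refl fix)
vertex-markFree⁻¹ (F ∷ t ∷ k) (l ∷ v) refl fix = flipped-∷ l (vertex-markFree⁻¹ (t ∷ k) v refl fix)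
vertex-markFree⁻¹ {h} (C₁ ∷ C₂ ∷ t ∷ k) (switchVH v) refl fix with vertex-markFree⁻¹ (t ∷ k) v refl fix
... | inj₁ v′ = inj₁ (switchVH v′)
... | inj₂ (x ∷ c' , v′ , refl) = inj₂ (_ , switchVH v′ , sym (flipLast-switchVH h x c'))
vertex-markFree⁻¹ {h} (C₁ ∷ C₂ ∷ t ∷ k) (switchHV v) refl fix with vertex-markFree⁻¹ (t ∷ k) v refl fix
... | inj₁ v′ = inj₁ (switchHV v′)
... | inj₂ (x ∷ c' , v′ , refl) = inj₂ (_ , switchHV v′ , sym (flipLast-switchHV h x c'))
vertex-markFree⁻¹ (C₂ ∷ [])        _        refl ()
vertex-markFree⁻¹ (C₂ ∷ _ ∷ _)     (() ∷ _) _    _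
vertex-markFree⁻¹ (C₁ ∷ _ ∷ [])    (() ∷ _) _    _
vertex-markFree⁻¹ (C₁ ∷ _ ∷ _ ∷ _) (() ∷ _) _    _

switch-turns : ∀ {h} j {k c} → Vertex h k c → tokenAt (suc j) k ≡ C₁ → tokenAt (suc (suc j)) k ≡ C₂ →
               T (not (dirAt (suc j) c ≡ᵈ dirAt (suc (suc j)) c))
switch-turns {false} zero (switchVH v) _ _ = _
switch-turns {true}  zero (switchVH v) _ _ = _
switch-turns {false} zero (switchHV v) _ _ = _
switch-turns {true}  zero (switchHV v) _ _ = _
switch-turns zero (l ∷ v) t≡C₁ _ = ⊥-elim (link≢C₁ l t≡C₁)
switch-turns (suc j) (l ∷ v) at₁ at₂ = switch-turns j v at₁ at₂
switch-turns (suc (suc j)) (switchVH v) at₁ at₂ = switch-turns j v at₁ at₂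
switch-turns (suc (suc j)) (switchHV v) at₁ at₂ = switch-turns j v at₁ at₂

tokenOf : Dir → Token
tokenOf E = H
tokenOf N = V
tokenOf S = V

-- the code of the cube with the single vertex c
codeOf : Config → Code
codeOf = map tokenOf

dim-codeOf : ∀ u → dim (codeOf u) ≡ 0
dim-codeOf []      = refl
dim-codeOf (E ∷ u) = dim-codeOf u
dim-codeOf (N ∷ u) = dim-codeOf u
dim-codeOf (S ∷ u) = dim-codeOf u

admissible⇒vertex : ∀ h l u → T (admissible h l u) → WellFormed l (codeOf u) × Vertex h (codeOf u) u
admissible⇒vertex h     l     []      _ = [] , []
admissible⇒vertex h     l     (E ∷ u) a = Product.map hor (hor ∷_) (admissible⇒vertex h false u a)
admissible⇒vertex false false (N ∷ u) a = Product.map ver (ver ∷_) (admissible⇒vertex true true u a)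
admissible⇒vertex true  false (S ∷ u) a = Product.map ver (ver ∷_) (admissible⇒vertex false true u a)

admissible⇒vertex-unique : ∀ h l u {c} → T (admissible h l u) → Vertex h (codeOf u) c → c ≡ u
admissible⇒vertex-unique h     l     []      _ []            = refl
admissible⇒vertex-unique h     l     (E ∷ u) a (hor ∷ v)     = cong (E ∷_) (admissible⇒vertex-unique h false u a v)
admissible⇒vertex-unique false false (N ∷ u) a (ver ∷ v)     = cong (N ∷_) (admissible⇒vertex-unique true true u a v)
admissible⇒vertex-unique true  false (S ∷ u) a (ver ∷ v)     = cong (S ∷_) (admissible⇒vertex-unique false true u a v)

admissible-weaken : ∀ h c → T (admissible h true c) → T (admissible h false c)
admissible-weaken h []      a = a
admissible-weaken h (E ∷ c) a = a
admissible-weaken false (N ∷ c) ()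
admissible-weaken true  (N ∷ c) ()
admissible-weaken false (S ∷ c) ()
admissible-weaken true  (S ∷ c) ()

vertex⇒admissible : ∀ {l h k c} → WellFormed l k → Vertex h k c → T (admissible h l c)
vertex⇒admissible []         []                   = _
vertex⇒admissible (hor w)    (hor ∷ v)            = vertex⇒admissible w v
vertex⇒admissible {h = false} (ver w) (ver ∷ v)   = vertex⇒admissible w v
vertex⇒admissible {h = true}  (ver w) (ver ∷ v)   = vertex⇒admissible w v
vertex⇒admissible {h = false} (switch w) (switchVH {c = c} v) = admissible-weaken true c (vertex⇒admissible w v)
vertex⇒admissible {h = true}  (switch w) (switchVH {c = c} v) = admissible-weaken false c (vertex⇒admissible w v)
vertex⇒admissible {h = false} (switch w) (switchHV v) = vertex⇒admissible w v
vertex⇒admissible {h = true}  (switch w) (switchHV v) = vertex⇒admissible w v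
vertex⇒admissible free (freeH ∷ [])              = _
vertex⇒admissible {h = false} free (freeV ∷ [])  = _
vertex⇒admissible {h = true}  free (freeV ∷ [])  = _

tokenAt-codeOf : ∀ j u → tokenAt (suc j) (codeOf u) ≡ tokenOf (dirAt (suc j) u)
tokenAt-codeOf j       []      = refl
tokenAt-codeOf zero    (d ∷ u) = refl
tokenAt-codeOf (suc j) (d ∷ u) = tokenAt-codeOf j u

fixed-tokenOf : ∀ d → Fixed (tokenOf d)
fixed-tokenOf E = H
fixed-tokenOf N = V
fixed-tokenOf S = V

fixed-codeOf : ∀ p u → Fixed (tokenAt p (codeOf u))
fixed-codeOf zero    u = H
fixed-codeOf (suc j) u = subst Fixed (sym (tokenAt-codeOf j u)) (fixed-tokenOf (dirAt (suc j) u))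

fixed-≢V : ∀ {t} → Fixed t → t ≢ V → t ≡ H
fixed-≢V H _   = refl
fixed-≢V V t≢V = ⊥-elim (t≢V refl)

no-vertical-pair : ∀ {l k} j → WellFormed l k → tokenAt (suc j) k ≡ V → tokenAt (suc (suc j)) k ≢ V
no-vertical-pair zero          (ver [])      _    ()
no-vertical-pair zero          (ver (hor w)) _    ()
no-vertical-pair (suc j)       (hor w)       at₁ at₂ = no-vertical-pair j w at₁ at₂
no-vertical-pair (suc j)       (ver w)       at₁ at₂ = no-vertical-pair j w at₁ at₂
no-vertical-pair (suc (suc j)) (switch w)    at₁ at₂ = no-vertical-pair j w at₁ at₂

switchable-tokenOf : ∀ x y → T (not (x ≡ᵈ y)) → (tokenOf x ≡ V → tokenOf y ≢ V) → Switchable (tokenOf x) (tokenOf y)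
switchable-tokenOf N E _ _  = VH
switchable-tokenOf S E _ _  = VH
switchable-tokenOf E N _ _  = HV
switchable-tokenOf E S _ _  = HV
switchable-tokenOf N S _ vv = ⊥-elim (vv refl refl)
switchable-tokenOf S N _ vv = ⊥-elim (vv refl refl)

tokenAt-swapAt₁ : ∀ j u → suc (suc j) ≤ length u →
                  tokenAt (suc j) (codeOf (swapAt (suc j) u)) ≡ tokenAt (suc (suc j)) (codeOf u)
tokenAt-swapAt₁ zero    (a ∷ b ∷ u) _         = refl
tokenAt-swapAt₁ zero    (a ∷ [])    (s≤s ())
tokenAt-swapAt₁ (suc j) (a ∷ u)     (s≤s len) rewrite swapAt-∷ j a u = tokenAt-swapAt₁ j u len

tokenAt-swapAt₂ : ∀ j u → suc (suc j) ≤ length u →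
                  tokenAt (suc (suc j)) (codeOf (swapAt (suc j) u)) ≡ tokenAt (suc j) (codeOf u)
tokenAt-swapAt₂ zero    (a ∷ b ∷ u) _         = refl
tokenAt-swapAt₂ zero    (a ∷ [])    (s≤s ())
tokenAt-swapAt₂ (suc j) (a ∷ u)     (s≤s len) rewrite swapAt-∷ j a u = tokenAt-swapAt₂ j u len

tokenAt-swapAt : ∀ j u {p} → p ≢ suc j → p ≢ suc (suc j) → tokenAt p (codeOf (swapAt (suc j) u)) ≡ tokenAt p (codeOf u)
tokenAt-swapAt j u {zero} _ _ = refl
tokenAt-swapAt j [] {suc p} _ _ = refl
tokenAt-swapAt j (a ∷ []) {suc p} _ _ = refl
tokenAt-swapAt zero (a ∷ b ∷ u) {suc zero} p≢ _ = ⊥-elim (p≢ refl)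
tokenAt-swapAt zero (a ∷ b ∷ u) {suc (suc zero)} _ p≢ = ⊥-elim (p≢ refl)
tokenAt-swapAt zero (a ∷ b ∷ u) {suc (suc (suc p))} _ _ = refl
tokenAt-swapAt (suc j) (a ∷ b ∷ u) {suc zero} _ _ = refl
tokenAt-swapAt (suc j) (a ∷ b ∷ u) {suc (suc p)} p≢ p≢′ =
  tokenAt-swapAt j (b ∷ u) {suc p} (p≢ ∘ cong suc) (p≢′ ∘ cong suc)

tokenAt-flipLast : ∀ h u {p} → p ≢ length u → tokenAt p (codeOf (flipLast h u)) ≡ tokenAt p (codeOf u)
tokenAt-flipLast h u {zero} _ = refl
tokenAt-flipLast h [] {suc p} _ = refl
tokenAt-flipLast h (d ∷ []) {suc zero} p≢ = ⊥-elim (p≢ refl)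
tokenAt-flipLast h (N ∷ []) {suc (suc p)} _ = refl
tokenAt-flipLast h (S ∷ []) {suc (suc p)} _ = refl
tokenAt-flipLast h (E ∷ []) {suc (suc p)} _ = refl
tokenAt-flipLast h (d ∷ d' ∷ u) {suc zero} _ = refl
tokenAt-flipLast h (d ∷ d' ∷ u) {suc (suc p)} p≢ = tokenAt-flipLast (next h d) (d' ∷ u) {suc p} (p≢ ∘ cong suc)

tokenAt-flipLast-last : ∀ h u {p} → length u ≡ suc p → tokenAt (suc p) (codeOf u) ≡ H →
                        tokenAt (suc p) (codeOf (flipLast h u)) ≡ V
tokenAt-flipLast-last false (E ∷ [])     refl _    = refl
tokenAt-flipLast-last true  (E ∷ [])     refl _    = refl
tokenAt-flipLast-last h     (d ∷ d' ∷ u) refl last = tokenAt-flipLast-last (next h d) (d' ∷ u) refl last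

record Exchanged (j : ℕ) (k k' : Code) : Set where
  field
    first  : tokenAt (suc j) k' ≡ tokenAt (suc (suc j)) k
    second : tokenAt (suc (suc j)) k' ≡ tokenAt (suc j) k
    others : ∀ {p} → p ≢ suc j → p ≢ suc (suc j) → tokenAt p k' ≡ tokenAt p k

exchanged-swapAt : ∀ j u → suc (suc j) ≤ length u → Exchanged j (codeOf u) (codeOf (swapAt (suc j) u))
exchanged-swapAt j u len = record
  { first  = tokenAt-swapAt₁ j u len
  ; second = tokenAt-swapAt₂ j u len
  ; others = tokenAt-swapAt j u }

module _ {j l l' k k'} (w : WellFormed l k) (w' : WellFormed l' k') (ex : Exchanged j k k') where
  open Exchanged ex

  exchange-right : Switchable (tokenAt (suc j) k) (tokenAt (suc (suc j)) k) → tokenAt (3 + j) k ≢ V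
  exchange-right sw v₃ = go sw refl refl
    where
    go : ∀ {a b} → Switchable a b → a ≡ tokenAt (suc j) k → b ≡ tokenAt (suc (suc j)) k → ⊥
    go VH a≡ _  = no-vertical-pair (suc j) w' (trans second (sym a≡)) (trans (others 3+j≢1+j 3+j≢2+j) v₃)
      where
      3+j≢1+j = >⇒≢ (ℕ.m≤n⇒m≤1+n (ℕ.n<1+n (suc j)))
      3+j≢2+j = >⇒≢ (ℕ.n<1+n (suc (suc j)))
    go HV _  b≡ = no-vertical-pair (suc j) w (sym b≡) v₃

  exchange-left : ∀ {i} → j ≡ suc i → Switchable (tokenAt (suc j) k) (tokenAt (suc (suc j)) k) → tokenAt (suc i) k ≢ V
  exchange-left refl sw v₀ = go sw refl refl
    where
    go : ∀ {a b} → Switchable a b → a ≡ tokenAt (suc j) k → b ≡ tokenAt (suc (suc j)) k → ⊥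
    go VH a≡ _  = no-vertical-pair _ w v₀ (sym a≡)
    go HV _  b≡ = no-vertical-pair _ w' (trans (others i≢1+i i≢2+i) v₀) (trans first (sym b≡))
      where
      i≢1+i = <⇒≢ (ℕ.n<1+n _)
      i≢2+i = <⇒≢ (ℕ.m≤n⇒m≤1+n (ℕ.n<1+n _))

flip-left : ∀ {l l' k k'} m → WellFormed l k → WellFormed l' k' → Fixed (tokenAt (suc (suc m)) k) →
            (∀ {p} → p ≢ suc (suc m) → tokenAt p k' ≡ tokenAt p k) →
            (tokenAt (suc (suc m)) k ≡ H → tokenAt (suc (suc m)) k' ≡ V) →
            tokenAt (suc m) k ≢ V
flip-left {k = k} m w w' fixed others flipped v₀ = go fixed refl
  where
  go : ∀ {t} → Fixed t → t ≡ tokenAt (suc (suc m)) k → ⊥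
  go V t≡ = no-vertical-pair m w v₀ (sym t≡)
  go H t≡ = no-vertical-pair m w' (trans (others (<⇒≢ (ℕ.n<1+n _))) v₀) (flipped (sym t≡))

T-not⁺ : ∀ {b} → ¬ T b → T (not b)
T-not⁺ {false} _  = _
T-not⁺ {true}  ¬t = ¬t _

T-not⁻ : ∀ {b} → T (not b) → ¬ T b
T-not⁻ {false} _ ()

disjoint⇒∉ : ∀ {xs ys x} → T (disjoint xs ys) → x ∈ xs → ¬ x ∈ ys
disjoint⇒∉ {xs} {ys} {x} xs#ys x∈xs x∈ys =
  T-not⁻ (All.lookup (All.all⁺ _ xs xs#ys) x∈xs)
         (Any.any⁺ (x ≡ᵇ_) (Any.map (λ { refl → ℕ.≡⇒≡ᵇ x x refl }) x∈ys))

disjoint⁺ : ∀ xs ys → (∀ {x y} → x ∈ xs → y ∈ ys → x ≢ y) → T (disjoint xs ys)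
disjoint⁺ xs ys apart = All.all⁻ _ (All.tabulate λ {x} x∈xs →
  T-not⁺ λ t → let y , y∈ys , x≡ᵇy = find (Any.any⁻ (x ≡ᵇ_) ys t) in apart x∈xs y∈ys (ℕ.≡ᵇ⇒≡ x y x≡ᵇy))

commute⇒unchanged : ∀ {n m ms p} → T (all (commute n m) ms) → p ∈ involved n m →
                    ∀ {m'} → m' ∈ ms → ¬ p ∈ changed n m'
commute⇒unchanged {n} {m} {ms} commutes p∈ m'∈ p∈changed =
  disjoint⇒∉ (proj₂ (Equivalence.to T-∧ (All.lookup (All.all⁺ (commute n m) ms commutes) m'∈))) p∈changed p∈

∈moves-corner : ∀ {n i} → corner i ∈ moves n → ∃ λ j → i ≡ suc j × suc (suc j) ≤ n
∈moves-corner {suc m} c∈ with ∈-++⁻ (map (λ k → corner (suc k)) (upTo m)) c∈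
... | inj₂ (here ())
... | inj₂ (there ())
... | inj₁ c∈corners with ∈-map⁻ (λ k → corner (suc k)) c∈corners
...   | j , j∈ , refl = j , refl , s≤s (∈-upTo⁻ j∈)

∈moves-flip : ∀ {n} → flip ∈ moves n → ∃ λ m → n ≡ suc m
∈moves-flip {suc m} _ = m , refl

∈-involved : ∀ n {p} xs → p ∈ xs → 1 ≤ p → p ≤ n → p ∈ filter (λ k → T? (inRange n k)) xs
∈-involved n xs p∈ 1≤p p≤n =
  ∈-filter⁺ (λ k → T? (inRange n k)) p∈ (Equivalence.from T-∧ (ℕ.≤⇒≤ᵇ 1≤p , ℕ.≤⇒≤ᵇ p≤n))

tokenAt-beyond : ∀ {p} k → length k < p → tokenAt p k ≡ H
tokenAt-beyond {suc p}       []      _         = refl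
tokenAt-beyond {suc (suc p)} (t ∷ k) (s≤s len) = tokenAt-beyond k len

cubeVertices-∷ : ∀ m ms u → cubeVertices (m ∷ ms) u ≡ cubeVertices ms u ++ map (apply m) (cubeVertices ms u)
cubeVertices-∷ m ms u =
  -- applyAll (m ∷ T) u is apply m (applyAll T u)
  trans (map-++ (λ T → applyAll T u) (subsets ms) (map (m ∷_) (subsets ms)))
        (cong (cubeVertices ms u ++_) (trans (sym (map-∘ (subsets ms))) (map-∘ (subsets ms))))

Spans : List Config → Code → Set
Spans X k = ∀ {c} → c ∈ X ⇔ Vertex false k c

spans-++-map : ∀ {X k k'} (f : Config → Config) →
               (∀ {c} → Vertex false k c → Vertex false k' c) →
               (∀ {c} → Vertex false k c → Vertex false k' (f c)) →
               (∀ {c} → Vertex false k' c → Vertex false k c ⊎ ∃ λ c' → Vertex false k c' × c ≡ f c') →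
               Spans X k → Spans (X ++ map f X) k'
spans-++-map {X} {k} {k'} f stay move split X-spans = mk⇔ to from
  where
  to : ∀ {c} → c ∈ X ++ map f X → Vertex false k' c
  to c∈ with ∈-++⁻ X c∈
  ... | inj₁ c∈X = stay (Equivalence.to X-spans c∈X)
  ... | inj₂ c∈fX with ∈-map⁻ f c∈fX
  ...   | _ , c'∈X , refl = move (Equivalence.to X-spans c'∈X)
  from : ∀ {c} → Vertex false k' c → c ∈ X ++ map f X
  from v with split v
  ... | inj₁ v′               = ∈-++⁺ˡ (Equivalence.from X-spans v′)
  ... | inj₂ (_ , v′ , refl)  = ∈-++⁺ʳ X (∈-map⁺ f (Equivalence.from X-spans v′))

mark : Move → Code → Code
mark (corner i) = markSwitch i
mark flip       = markFree

-- the hypotheses of wellFormed-markSwitch, which only involve links j to j + 3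
record SwitchWindow (j : ℕ) (k : Code) : Set where
  field
    switchable : Switchable (tokenAt (suc j) k) (tokenAt (suc (suc j)) k)
    left       : HorizontalBefore j false k
    right      : tokenAt (3 + j) k ≡ H

switch-window : ∀ {n} j u → suc (suc j) ≤ length u → T (admissible false false u) →
                T (applicable n (corner (suc j)) u) → SwitchWindow j (codeOf u)
switch-window {n} j u len u-admissible applies = record { switchable = switchable ; left = left j refl ; right = right }
  where
  turns×valid = Equivalence.to T-∧ applies
  w  = proj₁ (admissible⇒vertex false false u u-admissible)
  w' = proj₁ (admissible⇒vertex false false (swapAt (suc j) u) (valid⇒admissible {n} (swapAt (suc j) u) (proj₂ turns×valid)))
  exchanged = exchanged-swapAt j u len
  switchable : Switchable (tokenAt (suc j) (codeOf u)) (tokenAt (suc (suc j)) (codeOf u))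
  switchable = subst₂ Switchable (sym (tokenAt-codeOf j u)) (sym (tokenAt-codeOf (suc j) u))
    (switchable-tokenOf (dirAt (suc j) u) (dirAt (suc (suc j)) u) (proj₁ turns×valid) λ v₁ v₂ →
      no-vertical-pair j w (trans (tokenAt-codeOf j u) v₁) (trans (tokenAt-codeOf (suc j) u) v₂))
  right : tokenAt (3 + j) (codeOf u) ≡ H
  right = fixed-≢V (fixed-codeOf (3 + j) u) (exchange-right w w' exchanged switchable)
  left : ∀ i → i ≡ j → HorizontalBefore i false (codeOf u)
  left zero    _    = refl
  left (suc i) refl = fixed-≢V (fixed-codeOf (suc i) u) (exchange-left w w' exchanged refl switchable)

switchWindow-transport : ∀ j {k k'} →
                         (∀ {p} → p ∈ j ∷ suc j ∷ suc (suc j) ∷ 3 + j ∷ [] → tokenAt p k' ≡ tokenAt p k) →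
                         SwitchWindow j k → SwitchWindow j k'
switchWindow-transport j {k} {k'} same window = record
  { switchable = subst₂ Switchable (sym (same (there (here refl)))) (sym (same (there (there (here refl))))) switchable
  ; left       = left′ j refl
  ; right      = trans (same (there (there (there (here refl))))) right }
  where
  open SwitchWindow window
  left′ : ∀ i → i ≡ j → HorizontalBefore i false k'
  left′ zero    refl = refl
  left′ (suc i) refl = trans (same (here refl)) left

record FlipWindow (m : ℕ) (k : Code) : Set where
  field
    fixed : Fixed (tokenAt (suc m) k)
    left  : HorizontalBefore m false k

flip-window : ∀ {m} u → length u ≡ suc m → T (admissible false false u) → T (admissible false false (flipLast false u)) →
              FlipWindow m (codeOf u)
flip-window {m} u len u-admissible u'-admissible = record { fixed = fixed-codeOf (suc m) u ; left = left m refl }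
  where
  left : ∀ i → i ≡ m → HorizontalBefore i false (codeOf u)
  left zero    _    = refl
  left (suc i) refl =
    fixed-≢V (fixed-codeOf (suc i) u)
      (flip-left i (proj₁ (admissible⇒vertex false false u u-admissible))
        (proj₁ (admissible⇒vertex false false _ u'-admissible)) (fixed-codeOf (suc (suc i)) u)
        (λ p≢ → tokenAt-flipLast false u (λ p≡ → p≢ (trans p≡ len))) (tokenAt-flipLast-last false u len))

flipWindow-transport : ∀ m {k k'} → (∀ {p} → p ∈ m ∷ suc m ∷ [] → tokenAt p k' ≡ tokenAt p k) →
                       FlipWindow m k → FlipWindow m k'
flipWindow-transport m {k} {k'} same window = record
  { fixed = subst Fixed (sym (same (there (here refl)))) fixed
  ; left  = left′ m refl }
  where
  open FlipWindow window
  left′ : ∀ i → i ≡ m → HorizontalBefore i false k'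
  left′ zero    refl = refl
  left′ (suc i) refl = trans (same (here refl)) left

module CubeAt {n u} (u-length : length u ≡ n) (u-admissible : T (admissible false false u)) where

  code : List Move → Code
  code = foldr mark (codeOf u)

  Applicable : Move → Set
  Applicable m = m ∈ moves n × T (applicable n m u)

  record Coding (ms : List Move) : Set where
    field
      length-code : length (code ms) ≡ n
      unchanged   : ∀ p → (∀ {m} → m ∈ ms → ¬ p ∈ changed n m) → tokenAt p (code ms) ≡ tokenAt p (codeOf u)
      spans       : Spans (cubeVertices ms u) (code ms)
      wellFormed  : WellFormed false (code ms)
      dim-code    : dim (code ms) ≡ length ms

  length-codeOf : length (codeOf u) ≡ n
  length-codeOf = trans (length-map tokenOf u) u-length

  coding-[] : Coding []
  coding-[] = record
    { length-code = length-codeOf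
    ; unchanged   = λ _ _ → refl
    ; spans       = mk⇔ (λ { (here refl) → proj₂ u-coded }) (here ∘ admissible⇒vertex-unique false false u u-admissible)
    ; wellFormed  = proj₁ u-coded
    ; dim-code    = dim-codeOf u }
    where u-coded = admissible⇒vertex false false u u-admissible

  -- Out of the range [1, n] both codes read H, so only the in-range positions need the commutation.
  unchanged-around : ∀ {m ms} → Coding ms → T (all (commute n m) ms) →
                     ∀ p → (1 ≤ p → p ≤ n → p ∈ involved n m) → tokenAt p (code ms) ≡ tokenAt p (codeOf u)
  unchanged-around coding commutes zero _ = refl
  unchanged-around {m} {ms} coding commutes (suc p) involved-p with suc p ℕ.≤? n
  ... | yes p≤n = Coding.unchanged coding (suc p) (commute⇒unchanged {m = m} commutes (involved-p (s≤s z≤n) p≤n))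
  ... | no  p≰n = trans (tokenAt-beyond (code ms) (subst (_< suc p) (sym (Coding.length-code coding)) (ℕ.≰⇒> p≰n)))
                        (sym (tokenAt-beyond (codeOf u) (subst (_< suc p) (sym length-codeOf) (ℕ.≰⇒> p≰n))))

  coding-corner : ∀ {ms} i → Applicable (corner i) → T (all (commute n (corner i)) ms) → Coding ms → Coding (corner i ∷ ms)
  coding-corner {ms} i (i∈moves , applies) commutes coding with ∈moves-corner {n} i∈moves
  ... | j , refl , len = record
    { length-code = trans (length-markSwitch (suc j) K) length-code
    ; unchanged   = λ p unmarked →
        trans (tokenAt-markSwitch j K (unmarked (here refl) ∘ here) (unmarked (here refl) ∘ there ∘ here))
              (unchanged p (unmarked ∘ there))
    ; spans       = subst (λ X → Spans X (markSwitch (suc j) K)) (sym (cubeVertices-∷ (corner (suc j)) ms u))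
                      (spans-++-map (swapAt (suc j)) (λ v → vertex-markSwitch j v switchable)
                        (λ v → vertex-markSwitch-swapAt j v switchable len-K) split spans)
    ; wellFormed  = wellFormed-markSwitch j wellFormed switchable len-K left right
    ; dim-code    = trans (dim-markSwitch j switchable len-K) (cong suc dim-code) }
    where
    open Coding coding
    K = code ms
    len-K : suc (suc j) ≤ length K
    len-K = subst (suc (suc j) ≤_) (sym length-code) len
    open SwitchWindow (switchWindow-transport j
      (λ {p} p∈ → unchanged-around {corner (suc j)} coding commutes p
                    (∈-involved n (j ∷ suc j ∷ suc (suc j) ∷ 3 + j ∷ []) p∈))
      (switch-window j u (subst (suc (suc j) ≤_) (sym u-length) len) u-admissible applies))
    split : ∀ {c} → Vertex false (markSwitch (suc j) K) c →
            Vertex false K c ⊎ ∃ λ c' → Vertex false K c' × c ≡ swapAt (suc j) c'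
    split {c} v = Sum.map₂ (λ v′ → swapAt (suc j) c , v′ , sym (swapAt-involutive (suc j) c))
                           (vertex-markSwitch⁻¹ j v switchable)

  coding-flip : ∀ {ms} → Applicable flip → T (all (commute n flip) ms) → Coding ms → Coding (flip ∷ ms)
  coding-flip {ms} (f∈moves , applies) commutes coding with ∈moves-flip {n} f∈moves
  ... | m , n≡1+m = record
    { length-code = trans (length-markFree K) length-code
    ; unchanged   = λ p unmarked →
        trans (tokenAt-markFree K (λ p≡ → unmarked (here refl) (here (trans p≡ length-code))))
              (unchanged p (unmarked ∘ there))
    ; spans       = subst (λ X → Spans X (markFree K)) (sym (cubeVertices-∷ flip ms u))
                      (spans-++-map rotLast (λ v → vertex-markFree v len-K fixed) move split spans)
    ; wellFormed  = wellFormed-markFree wellFormed len-K fixed left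
    ; dim-code    = trans (dim-markFree K len-K fixed) (cong suc dim-code) }
    where
    open Coding coding
    K = code ms
    len-K : length K ≡ suc m
    len-K = trans length-code n≡1+m
    u'-admissible : T (admissible false false (flipLast false u))
    u'-admissible = subst (T ∘ admissible false false) (rotLast≡flipLast u u-admissible) (valid⇒admissible (rotLast u) applies)
    open FlipWindow (flipWindow-transport m
      (λ {p} p∈ → unchanged-around {flip} coding commutes p
                    (∈-involved n (n ∸ 1 ∷ n ∷ []) (subst (λ n → p ∈ n ∸ 1 ∷ n ∷ []) (sym n≡1+m) p∈)))
      (flip-window u (trans u-length n≡1+m) u-admissible u'-admissible))
    rotLast≡ : ∀ {c} → Vertex false K c → rotLast c ≡ flipLast false c
    rotLast≡ {c} v = rotLast≡flipLast c (vertex⇒admissible wellFormed v)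
    move : ∀ {c} → Vertex false K c → Vertex false (markFree K) (rotLast c)
    move v rewrite rotLast≡ v = vertex-markFree-flipLast v len-K fixed
    split : ∀ {c} → Vertex false (markFree K) c → Vertex false K c ⊎ ∃ λ c' → Vertex false K c' × c ≡ rotLast c'
    split v = Sum.map₂ (λ { (c' , v′ , refl) → c' , v′ , sym (rotLast≡ v′) }) (vertex-markFree⁻¹ K v len-K fixed)

  coding : ∀ ms → All Applicable ms → T (pairwiseCommute n ms) → Coding ms
  coding []       []           _           = coding-[]
  coding (m ∷ ms) (app ∷ apps) commuting   = coding-∷ m app commutes (coding ms apps rest)
    where
    commutes×rest = Equivalence.to (T-∧ {all (commute n m) ms}) commuting
    commutes = proj₁ commutes×rest
    rest     = proj₂ commutes×rest
    coding-∷ : ∀ m → Applicable m → T (all (commute n m) ms) → Coding ms → Coding (m ∷ ms)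
    coding-∷ (corner i) = coding-corner i
    coding-∷ flip       = coding-flip

∈-subsets⁻ : ∀ {A : Set} (xs : List A) {ys} → ys ∈ subsets xs → ys ⊆ xs
∈-subsets⁻ []       (here refl) = []
∈-subsets⁻ (x ∷ xs) ys∈ with ∈-++⁻ (subsets xs) ys∈
... | inj₁ ys∈′ = x ∷ʳ ∈-subsets⁻ xs ys∈′
... | inj₂ ys∈′ with ∈-map⁻ (x ∷_) ys∈′
...   | _ , ys∈″ , refl = refl ∷ ∈-subsets⁻ xs ys∈″

∈-subsets⁺ : ∀ {A : Set} {xs ys : List A} → ys ⊆ xs → ys ∈ subsets xs
∈-subsets⁺ []                       = here refl
∈-subsets⁺ (_ ∷ʳ ys⊆xs)             = ∈-++⁺ˡ (∈-subsets⁺ ys⊆xs)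
∈-subsets⁺ {xs = x ∷ xs} (refl ∷ ys⊆xs) = ∈-++⁺ʳ (subsets xs) (∈-map⁺ (x ∷_) (∈-subsets⁺ ys⊆xs))

applicableMoves : ℕ → Config → List Move
applicableMoves n u = filter (λ m → T? (applicable n m u)) (moves n)

commutingSets : ℕ → ℕ → Config → List (List Move)
commutingSets n d u = filter (λ ms → T? ((length ms ≡ᵇ d) ∧ pairwiseCommute n ms)) (subsets (applicableMoves n u))

cubesAt : ℕ → ℕ → Config → List (List Config)
cubesAt n d u = map (λ ms → cubeVertices ms u) (commutingSets n d u)

Represents : List Config → Code → Set
Represents X k = WellFormed false k × Spans X k

cube⇒code : ∀ n d {X} → X ∈ cubesWithRep n d → ∃ λ k → k ∈ codes n d × Represents X k
cube⇒code n d X∈ with find (∈-concatMap⁻ (cubesAt n d) {xs = states n} X∈)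
... | u , u∈states , X∈cubesAt with ∈-map⁻ (λ ms → cubeVertices ms u) X∈cubesAt
...   | ms , ms∈ , refl
  with ∈-filter⁻ (λ ms → T? ((length ms ≡ᵇ d) ∧ pairwiseCommute n ms)) {xs = subsets (applicableMoves n u)} ms∈
...     | ms⊆ , size×commuting = code ms , code∈codes , wellFormed , spans
  where
  u-valid = proj₂ (∈-filter⁻ (λ c → T? (valid n c)) {xs = words n} u∈states)
  open CubeAt {n} {u} (valid⇒length u u-valid) (valid⇒admissible u u-valid)
  size≡d = ℕ.≡ᵇ⇒≡ (length ms) d (proj₁ (Equivalence.to T-∧ size×commuting))
  applicables : All Applicable ms
  applicables = All.tabulate λ m∈ →
    ∈-filter⁻ (λ m → T? (applicable n m u)) {xs = moves n} (Sublist.lookup (∈-subsets⁻ _ ms⊆) m∈)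
  open Coding (coding ms applicables (proj₂ (Equivalence.to (T-∧ {length ms ≡ᵇ d}) size×commuting)))
  code∈codes : code ms ∈ codes n d
  code∈codes = subst₂ (λ n d → code ms ∈ codes n d) length-code (trans dim-code size≡d) (wellFormed⇒∈codes wellFormed)

shift : Move → Move
shift (corner i) = corner (suc i)
shift flip       = flip

moves-suc : ∀ m → moves (suc (suc m)) ≡ corner 1 ∷ map shift (moves (suc m))
moves-suc m = cong (corner 1 ∷_) (begin
  map corner₁₊ (applyUpTo suc m) ++ flip ∷ []            ≡⟨ cong (_++ flip ∷ []) corners ⟩
  map shift (map corner₁₊ (upTo m)) ++ map shift (flip ∷ []) ≡⟨ map-++ shift (map corner₁₊ (upTo m)) (flip ∷ []) ⟨
  map shift (map corner₁₊ (upTo m) ++ flip ∷ [])          ∎)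
  where
  open ≡-Reasoning
  corner₁₊ : ℕ → Move
  corner₁₊ k = corner (suc k)
  corners : map corner₁₊ (applyUpTo suc m) ≡ map shift (map corner₁₊ (upTo m))
  corners = trans (map-applyUpTo suc corner₁₊ m) (sym (trans (sym (map-∘ (upTo m))) (map-upTo (shift ∘ corner₁₊) m)))

-- the moves spanning the cube with a given code from its base vertex
movesOf : ∀ {l k} → WellFormed l k → List Move
movesOf []         = []
movesOf (hor w)    = map shift (movesOf w)
movesOf (ver w)    = map shift (movesOf w)
movesOf (switch w) = corner 1 ∷ map shift (map shift (movesOf w))
movesOf free       = flip ∷ []

length-movesOf : ∀ {l k} (w : WellFormed l k) → length (movesOf w) ≡ dim k
length-movesOf []         = refl
length-movesOf (hor w)    = trans (length-map shift (movesOf w)) (length-movesOf w)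
length-movesOf (ver w)    = trans (length-map shift (movesOf w)) (length-movesOf w)
length-movesOf (switch w) =
  cong suc (trans (length-map shift (map shift (movesOf w))) (trans (length-map shift (movesOf w)) (length-movesOf w)))
length-movesOf free       = refl

map-shift-⊆ : ∀ {ms} L → ms ⊆ moves L → map shift ms ⊆ moves (suc L)
map-shift-⊆ zero    []    = Sublist.minimum _
map-shift-⊆ (suc L) ms⊆ rewrite moves-suc L = corner 1 ∷ʳ Sublistₚ.map⁺ shift ms⊆

movesOf⊆moves : ∀ {l k} (w : WellFormed l k) → movesOf w ⊆ moves (length k)
movesOf⊆moves []                 = []
movesOf⊆moves (hor {k = k} w)    = map-shift-⊆ (length k) (movesOf⊆moves w)
movesOf⊆moves (ver {k = k} w)    = map-shift-⊆ (length k) (movesOf⊆moves w)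
movesOf⊆moves (switch {k = k} w) rewrite moves-suc (length k) =
  refl ∷ Sublistₚ.map⁺ shift (map-shift-⊆ (length k) (movesOf⊆moves w))
movesOf⊆moves free               = refl ∷ []

length-marks : ∀ ms k → length (foldr mark k ms) ≡ length k
length-marks []              k = refl
length-marks (corner i ∷ ms) k = trans (length-markSwitch i (foldr mark k ms)) (length-marks ms k)
length-marks (flip ∷ ms)     k = trans (length-markFree (foldr mark k ms)) (length-marks ms k)

markFree-∷ : ∀ t {m} k → length k ≡ suc m → markFree (t ∷ k) ≡ t ∷ markFree k
markFree-∷ t (_ ∷ _) _ = refl

marks-shift : ∀ t k ms → ms ⊆ moves (length k) → foldr mark (t ∷ k) (map shift ms) ≡ t ∷ foldr mark k ms
marks-shift t k []       _       = refl
marks-shift t k (corner i ∷ ms) ms⊆ with ∈moves-corner {length k} (Sublist.lookup ms⊆ (here refl))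
... | j , refl , _ = cong (markSwitch (2 + j)) (marks-shift t k ms (Sublistₚ.∷ˡ⁻ ms⊆))
marks-shift t k (flip ∷ ms)     ms⊆ with ∈moves-flip {length k} (Sublist.lookup ms⊆ (here refl))
... | _ , len = trans (cong markFree (marks-shift t k ms (Sublistₚ.∷ˡ⁻ ms⊆)))
                      (markFree-∷ t (foldr mark k ms) (trans (length-marks ms k) len))

tokenOf-rise : ∀ h → tokenOf (rise h) ≡ V
tokenOf-rise false = refl
tokenOf-rise true  = refl

length-codeOf-base : ∀ {l k} h (w : WellFormed l k) → length (codeOf (base h w)) ≡ length k
length-codeOf-base h w = trans (length-map tokenOf (base h w)) (vertex-length (vertex-base h w))

movesOf⊆codeOf-base : ∀ {l k} h (w : WellFormed l k) → movesOf w ⊆ moves (length (codeOf (base h w)))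
movesOf⊆codeOf-base h w = subst (λ L → movesOf w ⊆ moves L) (sym (length-codeOf-base h w)) (movesOf⊆moves w)

code-movesOf : ∀ {l k} h (w : WellFormed l k) → foldr mark (codeOf (base h w)) (movesOf w) ≡ k
code-movesOf h []         = refl
code-movesOf h (hor w)    =
  trans (marks-shift H (codeOf (base h w)) (movesOf w) (movesOf⊆codeOf-base h w)) (cong (H ∷_) (code-movesOf h w))
code-movesOf h (ver w) rewrite tokenOf-rise h =
  trans (marks-shift V (codeOf (base (not h) w)) (movesOf w) (movesOf⊆codeOf-base (not h) w))
        (cong (V ∷_) (code-movesOf (not h) w))
code-movesOf h (switch {k = k} w) rewrite tokenOf-rise h =
  cong (markSwitch 1) (begin
    foldr mark (V ∷ H ∷ B) (map shift (map shift (movesOf w)))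
      ≡⟨ marks-shift V (H ∷ B) (map shift (movesOf w)) (map-shift-⊆ (length B) (movesOf⊆codeOf-base (not h) w)) ⟩
    V ∷ foldr mark (H ∷ B) (map shift (movesOf w))
      ≡⟨ cong (V ∷_) (marks-shift H B (movesOf w) (movesOf⊆codeOf-base (not h) w)) ⟩
    V ∷ H ∷ foldr mark B (movesOf w)
      ≡⟨ cong (λ k → V ∷ H ∷ k) (code-movesOf (not h) w) ⟩
    V ∷ H ∷ k
      ∎)
  where
  open ≡-Reasoning
  B = codeOf (base (not h) w)
code-movesOf h free       = refl

∈-map-shift-corner : ∀ {ms i} → corner i ∈ map shift ms → ∃ λ i' → i ≡ suc i' × corner i' ∈ ms
∈-map-shift-corner {ms} c∈ with ∈-map⁻ shift c∈
... | corner i' , c∈′ , refl = i' , refl , c∈′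

∈-map-shift-flip : ∀ {ms} → flip ∈ map shift ms → flip ∈ ms
∈-map-shift-flip {ms} f∈ with ∈-map⁻ shift f∈
... | flip , f∈′ , refl = f∈′

movesOf-corner : ∀ {l k i} (w : WellFormed l k) → corner i ∈ movesOf w →
                 ∃ λ j → i ≡ suc j × tokenAt (suc j) k ≡ C₁ × tokenAt (suc (suc j)) k ≡ C₂
movesOf-corner (hor w) c∈ with ∈-map-shift-corner c∈
... | _ , refl , c∈′ with movesOf-corner w c∈′
...   | j , refl , at₁ , at₂ = suc j , refl , at₁ , at₂
movesOf-corner (ver w) c∈ with ∈-map-shift-corner c∈
... | _ , refl , c∈′ with movesOf-corner w c∈′
...   | j , refl , at₁ , at₂ = suc j , refl , at₁ , at₂
movesOf-corner (switch w) (here refl) = zero , refl , refl , refl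
movesOf-corner (switch w) (there c∈) with ∈-map-shift-corner c∈
... | _ , refl , c∈′ with ∈-map-shift-corner c∈′
...   | _ , refl , c∈″ with movesOf-corner w c∈″
...     | j , refl , at₁ , at₂ = suc (suc j) , refl , at₁ , at₂
movesOf-corner free (here ())
movesOf-corner free (there ())

movesOf-flip : ∀ {l k} (w : WellFormed l k) → flip ∈ movesOf w → ∃ λ m → length k ≡ suc m × tokenAt (suc m) k ≡ F
movesOf-flip (hor {k = _ ∷ _} w) f∈ with movesOf-flip w (∈-map-shift-flip f∈)
... | m , refl , last = suc m , refl , last
movesOf-flip (ver {k = _ ∷ _} w) f∈ with movesOf-flip w (∈-map-shift-flip f∈)
... | m , refl , last = suc m , refl , last
movesOf-flip (switch {k = _ ∷ _} w) (there f∈) with movesOf-flip w (∈-map-shift-flip (∈-map-shift-flip f∈))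
... | m , refl , last = suc (suc m) , refl , last
movesOf-flip free _ = zero , refl , refl
movesOf-flip (hor [])          ()
movesOf-flip (ver [])          ()
movesOf-flip (switch [])       (there ())

Far : ℕ → Move → Move → Set
Far n (corner i) (corner j) = 3 + i ≤ j
Far n (corner i) flip       = 3 + i ≤ n
Far n flip       _          = ⊥

far-shift : ∀ {n} m m' → Far n m m' → Far (suc n) (shift m) (shift m')
far-shift (corner i) (corner j) far = s≤s far
far-shift (corner i) flip       far = s≤s far

allPairs-far-shift : ∀ {n ms} → AllPairs (Far n) ms → AllPairs (Far (suc n)) (map shift ms)
allPairs-far-shift []             = []
allPairs-far-shift (far ∷ apart) = All.map⁺ (All.map (far-shift _ _) far) ∷ allPairs-far-shift apart

-- after a switch comes a horizontal link, so the next move is at least three links further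
far-after-switch : ∀ {k} (w : WellFormed true k) → All (Far (2 + length k) (corner 1)) (map shift (map shift (movesOf w)))
far-after-switch []              = []
far-after-switch (hor {k = k} w) = All.tabulate λ m∈ → go (∈-map⁻ shift m∈)
  where
  go : ∀ {m} → ∃ (λ m' → m' ∈ map shift (map shift (movesOf w)) × m ≡ shift m') → Far (3 + length k) (corner 1) m
  go (m' , m'∈ , refl) with ∈-map⁻ shift m'∈
  ... | m″ , m″∈ , refl with ∈-map⁻ shift m″∈
  ...   | corner i , i∈ , refl with ∈moves-corner {length k} (Sublist.lookup (movesOf⊆moves w) i∈)
  ...     | _ , refl , _ = s≤s (s≤s (s≤s (s≤s z≤n)))
  go (m' , m'∈ , refl) | m″ , m″∈ , refl | flip , f∈ , refl
    with ∈moves-flip {length k} (Sublist.lookup (movesOf⊆moves w) f∈)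
  ...     | m , len = subst (λ L → 4 ≤ 3 + L) (sym len) (ℕ.m≤m+n 4 m)

movesOf-far : ∀ {l k} (w : WellFormed l k) → AllPairs (Far (length k)) (movesOf w)
movesOf-far []         = []
movesOf-far (hor w)    = allPairs-far-shift (movesOf-far w)
movesOf-far (ver w)    = allPairs-far-shift (movesOf-far w)
movesOf-far (switch w) = far-after-switch w ∷ allPairs-far-shift (allPairs-far-shift (movesOf-far w))
movesOf-far free       = [] ∷ []

involved-corner : ∀ n i {p} → p ∈ involved n (corner i) → i ∸ 1 ≤ p × p ≤ 2 + i
involved-corner n i p∈ with proj₁ (∈-filter⁻ (λ k → T? (inRange n k)) {xs = i ∸ 1 ∷ i ∷ suc i ∷ 2 + i ∷ []} p∈)
... | here refl                         = ℕ.≤-refl , ℕ.≤-trans (ℕ.m∸n≤m i 1) (ℕ.m≤n+m i 2)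
... | there (here refl)                 = ℕ.m∸n≤m i 1 , ℕ.m≤n+m i 2
... | there (there (here refl))         = ℕ.≤-trans (ℕ.m∸n≤m i 1) (ℕ.n≤1+n i) , ℕ.n≤1+n (suc i)
... | there (there (there (here refl))) = ℕ.≤-trans (ℕ.m∸n≤m i 1) (ℕ.m≤n+m i 2) , ℕ.≤-refl

involved-flip : ∀ n {p} → p ∈ involved n flip → n ∸ 1 ≤ p
involved-flip n p∈ with proj₁ (∈-filter⁻ (λ k → T? (inRange n k)) {xs = n ∸ 1 ∷ n ∷ []} p∈)
... | here refl         = ℕ.≤-refl
... | there (here refl) = ℕ.m∸n≤m n 1

changed-corner : ∀ {i p} → p ∈ i ∷ suc i ∷ [] → i ≤ p × p ≤ suc i
changed-corner (here refl)         = ℕ.≤-refl , ℕ.n≤1+n _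
changed-corner (there (here refl)) = ℕ.n≤1+n _ , ℕ.≤-refl

far-commute : ∀ n m m' → Far n m m' → T (commute n m m')
far-commute n (corner i) (corner j) far = Equivalence.from T-∧
  ( disjoint⁺ (changed n (corner i)) (involved n (corner j)) (λ x∈ y∈ →
      <⇒≢ (ℕ.≤-trans (s≤s (proj₂ (changed-corner x∈)))
                     (ℕ.≤-trans (ℕ.∸-monoˡ-≤ 1 far) (proj₁ (involved-corner n j y∈)))))
  , disjoint⁺ (changed n (corner j)) (involved n (corner i)) (λ x∈ y∈ →
      >⇒≢ (ℕ.≤-trans (s≤s (proj₂ (involved-corner n i y∈))) (ℕ.≤-trans far (proj₁ (changed-corner x∈))))) )
far-commute n (corner i) flip far = Equivalence.from T-∧
  ( disjoint⁺ (changed n (corner i)) (involved n flip) (λ x∈ y∈ →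
      <⇒≢ (ℕ.≤-trans (s≤s (proj₂ (changed-corner x∈))) (ℕ.≤-trans (ℕ.∸-monoˡ-≤ 1 far) (involved-flip n y∈))))
  , disjoint⁺ (changed n flip) (involved n (corner i)) λ { (here refl) y∈ →
      >⇒≢ (ℕ.≤-trans (s≤s (proj₂ (involved-corner n i y∈))) far) } )

pairwiseCommute-far : ∀ n ms → AllPairs (Far n) ms → T (pairwiseCommute n ms)
pairwiseCommute-far n []       []              = _
pairwiseCommute-far n (m ∷ ms) (far ∷ apart) =
  Equivalence.from T-∧ (All.all⁻ (commute n m) (All.map (far-commute n m _) far) , pairwiseCommute-far n ms apart)

∈-words : ∀ c → c ∈ words (length c)
∈-words []      = here refl
∈-words (d ∷ c) =
  ∈-concatMap⁺ (λ w → (N ∷ w) ∷ (S ∷ w) ∷ (E ∷ w) ∷ []) (Any.map (λ { refl → extend d }) (∈-words c))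
  where
  extend : ∀ d → d ∷ c ∈ (N ∷ c) ∷ (S ∷ c) ∷ (E ∷ c) ∷ []
  extend N = here refl
  extend S = there (here refl)
  extend E = there (there (here refl))

code⇒cube : ∀ n d {k} → k ∈ codes n d → ∃ λ X → X ∈ cubesWithRep n d × Represents X k
code⇒cube n d {k} k∈ with ∈codes⇒coded n d k∈
... | w , refl , refl =
  cubeVertices ms u , X∈cubes , w , subst (Spans (cubeVertices ms u)) (code-movesOf false w) spans
  where
  u = base false w
  u-vertex = vertex-base false w
  u-admissible = vertex⇒admissible w u-vertex
  vertex-valid : ∀ {c} → Vertex false k c → T (valid n c)
  vertex-valid {c} v = subst T (sym (valid≡admissible c (vertex-length v))) (vertex⇒admissible w v)
  ms = movesOf w
  applicable-movesOf : ∀ {m} → m ∈ ms → T (applicable n m u)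
  applicable-movesOf {corner i} c∈ with movesOf-corner w c∈
  ... | j , refl , at₁ , at₂ =
    Equivalence.from T-∧ (switch-turns j u-vertex at₁ at₂ , vertex-valid (vertex-swapAt j u-vertex at₁ at₂))
  applicable-movesOf {flip} f∈ with movesOf-flip w f∈
  ... | _ , len , last = subst (T ∘ valid n) (sym (rotLast≡flipLast u u-admissible))
                                (vertex-valid (vertex-flipLast u-vertex len last))
  commuting = pairwiseCommute-far n ms (movesOf-far w)
  open CubeAt {n} {u} (vertex-length u-vertex) u-admissible
  open Coding (coding ms (All.tabulate λ m∈ → Sublist.lookup (movesOf⊆moves w) m∈ , applicable-movesOf m∈) commuting)
  ms⊆ : ms ⊆ applicableMoves n u
  ms⊆ = subst (_⊆ applicableMoves n u) (filter-all (λ m → T? (applicable n m u)) (All.tabulate applicable-movesOf))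
              (Sublistₚ.filter⁺ (λ m → T? (applicable n m u)) (λ m → T? (applicable n m u)) (λ { refl a → a })
                (movesOf⊆moves w))
  ms∈ : ms ∈ commutingSets n (dim k) u
  ms∈ = ∈-filter⁺ (λ ms → T? ((length ms ≡ᵇ dim k) ∧ pairwiseCommute n ms)) (∈-subsets⁺ ms⊆)
          (Equivalence.from T-∧ (ℕ.≡⇒≡ᵇ (length ms) (dim k) (length-movesOf w) , commuting))
  u∈states : u ∈ states n
  u∈states = ∈-filter⁺ (λ c → T? (valid n c)) (subst (λ L → u ∈ words L) (vertex-length u-vertex) (∈-words u))
                        (vertex-valid u-vertex)
  X∈cubes : cubeVertices ms u ∈ cubesWithRep n (dim k)
  X∈cubes = ∈-concatMap⁺ (cubesAt n (dim k)) (Any.map (λ { refl → ∈-map⁺ (λ ms → cubeVertices ms u) ms∈ }) u∈states)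

remove : ∀ {A : Set} {y : A} (ys : List A) → y ∈ ys → List A
remove (_ ∷ ys) (here _)  = ys
remove (z ∷ ys) (there p) = z ∷ remove ys p

length-remove : ∀ {A : Set} {y : A} (ys : List A) (p : y ∈ ys) → length ys ≡ suc (length (remove ys p))
length-remove (_ ∷ ys) (here _)  = refl
length-remove (z ∷ ys) (there p) = cong suc (length-remove ys p)

∈-remove : ∀ {A : Set} {y y' : A} (ys : List A) (p : y ∈ ys) → y' ∈ ys → y' ≡ y ⊎ y' ∈ remove ys p
∈-remove (_ ∷ ys) (here refl) (here refl) = inj₁ refl
∈-remove (_ ∷ ys) (here refl) (there q)   = inj₂ q
∈-remove (z ∷ ys) (there p)   (here refl) = inj₂ (here refl)
∈-remove (z ∷ ys) (there p)   (there q)   = Sum.map₂ there (∈-remove ys p q)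

length-≤-injection : ∀ {A B : Set} (R : A → B → Set) (xs : List A) (ys : List B) →
                     (∀ {x} → x ∈ xs → ∃ λ y → y ∈ ys × R x y) →
                     AllPairs (λ x x' → ∀ {y} → R x y → ¬ R x' y) xs →
                     length xs ≤ length ys
length-≤-injection R []       ys partner _ = z≤n
length-≤-injection R (x ∷ xs) ys partner (x-alone ∷ apart) with partner (here refl)
... | y , y∈ys , Rxy rewrite length-remove ys y∈ys =
  s≤s (length-≤-injection R xs (remove ys y∈ys) partner′ apart)
  where
  partner′ : ∀ {x'} → x' ∈ xs → ∃ λ y' → y' ∈ remove ys y∈ys × R x' y'
  partner′ x'∈ with partner (there x'∈)
  ... | y' , y'∈ys , Rx'y' with ∈-remove ys y∈ys y'∈ys
  ...   | inj₂ y'∈ = y' , y'∈ , Rx'y'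
  ...   | inj₁ refl = ⊥-elim (All.lookup x-alone x'∈ Rxy Rx'y')

-- Counting the classes of a list modulo a boolean relation by a list of canonical representatives
module _ {A B : Set} (_≈ᵇ_ : A → A → Bool) (Represents : A → B → Set)
         (represents-resp : ∀ {a b k} → T (b ≈ᵇ a) → Represents a k → Represents b k)
         (represents-≈ : ∀ {a b k} → Represents a k → Represents b k → T (a ≈ᵇ b))
         (represents-functional : ∀ {a k k'} → Represents a k → Represents a k' → k ≡ k') where

  private
    deduplicate-apart : ∀ xs → AllPairs (λ a b → ¬ T (a ≈ᵇ b)) (deduplicateᵇ _≈ᵇ_ xs)
    deduplicate-apart []       = []
    deduplicate-apart (x ∷ xs) =
      All.all-filter (¬? ∘ T? ∘ (x ≈ᵇ_)) (deduplicateᵇ _≈ᵇ_ xs)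
        ∷ AllPairs.filter⁺ (¬? ∘ T? ∘ (x ≈ᵇ_)) (deduplicate-apart xs)

  length-deduplicateᵇ : ∀ xs ks → (∀ {x} → x ∈ xs → ∃ λ k → k ∈ ks × Represents x k) →
                        (∀ {k} → k ∈ ks → ∃ λ x → x ∈ xs × Represents x k) → Unique ks →
                        length (deduplicateᵇ _≈ᵇ_ xs) ≡ length ks
  length-deduplicateᵇ xs ks represented representing ks-unique = ℕ.≤-antisym
    (length-≤-injection Represents classes ks (represented ∘ Any.deduplicate⁻ (T? ∘₂ _≈ᵇ_))
      (AllPairs.map (λ ¬a≈b {k} Rak Rbk → ¬a≈b (represents-≈ Rak Rbk)) (deduplicate-apart xs)))
    (length-≤-injection (λ k x → Represents x k) ks classes class
      (AllPairs.map (λ k≢k' {x} Rxk Rxk' → k≢k' (represents-functional Rxk Rxk')) ks-unique))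
    where
    classes = deduplicateᵇ _≈ᵇ_ xs
    class : ∀ {k} → k ∈ ks → ∃ λ x → x ∈ classes × Represents x k
    class k∈ with representing k∈
    ... | x , x∈ , Rxk =
      find (Any.deduplicate⁺ (T? ∘₂ _≈ᵇ_) (λ b≈a Rak → represents-resp b≈a Rak) (Any.map (λ { refl → Rxk }) x∈))

≡ᵈ⇒≡ : ∀ a b → T (a ≡ᵈ b) → a ≡ b
≡ᵈ⇒≡ N N _ = refl
≡ᵈ⇒≡ S S _ = refl
≡ᵈ⇒≡ E E _ = refl

≡ᵈ-refl : ∀ a → T (a ≡ᵈ a)
≡ᵈ-refl N = _
≡ᵈ-refl S = _
≡ᵈ-refl E = _

≡ᶜ⇒≡ : ∀ a b → T (a ≡ᶜ b) → a ≡ b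
≡ᶜ⇒≡ []      []      _  = refl
≡ᶜ⇒≡ (x ∷ a) (y ∷ b) eq =
  let x≡y , a≡b = Equivalence.to (T-∧ {x ≡ᵈ y}) eq in cong₂ _∷_ (≡ᵈ⇒≡ x y x≡y) (≡ᶜ⇒≡ a b a≡b)

≡ᶜ-refl : ∀ a → T (a ≡ᶜ a)
≡ᶜ-refl []      = _
≡ᶜ-refl (x ∷ a) = Equivalence.from T-∧ (≡ᵈ-refl x , ≡ᶜ-refl a)

⊆ᵇ⇔⊆ : ∀ xs ys → T (xs ⊆ᵇ ys) ⇔ (∀ {x} → x ∈ xs → x ∈ ys)
⊆ᵇ⇔⊆ xs ys = mk⇔
  (λ xs⊆ys {x} x∈ → let y , y∈ , x≡y = find (Any.any⁻ (x ≡ᶜ_) ys (All.lookup (All.all⁺ _ xs xs⊆ys) x∈))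
                    in subst (_∈ ys) (sym (≡ᶜ⇒≡ x y x≡y)) y∈)
  (λ xs⊆ys → All.all⁻ _ (All.tabulate λ {x} x∈ →
     Any.any⁺ (x ≡ᶜ_) (Any.map (λ { refl → ≡ᶜ-refl x }) (xs⊆ys x∈))))

sameSet⇔ : ∀ xs ys → T (sameSet xs ys) ⇔ (∀ {x} → x ∈ xs ⇔ x ∈ ys)
sameSet⇔ xs ys = mk⇔
  (λ same → let xs⊆ys , ys⊆xs = Equivalence.to (T-∧ {xs ⊆ᵇ ys}) same
            in λ {x} → mk⇔ (Equivalence.to (⊆ᵇ⇔⊆ xs ys) xs⊆ys) (Equivalence.to (⊆ᵇ⇔⊆ ys xs) ys⊆xs))
  (λ same → Equivalence.from T-∧ ( Equivalence.from (⊆ᵇ⇔⊆ xs ys) (λ {x} → Equivalence.to (same {x}))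
                                  , Equivalence.from (⊆ᵇ⇔⊆ ys xs) (λ {x} → Equivalence.from (same {x}))))

s≡length-codes : ∀ n d → s n d ≡ length (codes n d)
s≡length-codes n d =
  length-deduplicateᵇ sameSet Represents represents-resp represents-sameSet represents-functional
    (cubesWithRep n d) (codes n d) (cube⇒code n d) (code⇒cube n d) (unique-codes n d)
  where
  represents-resp : ∀ {X Y k} → T (sameSet Y X) → Represents X k → Represents Y k
  represents-resp {X} {Y} Y≈X (w , X-spans) = w , X-spans ⇔-∘ Equivalence.to (sameSet⇔ Y X) Y≈X
  represents-sameSet : ∀ {X Y k} → Represents X k → Represents Y k → T (sameSet X Y)
  represents-sameSet {X} {Y} (_ , X-spans) (_ , Y-spans) =
    Equivalence.from (sameSet⇔ X Y) (⇔-sym Y-spans ⇔-∘ X-spans)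
  represents-functional : ∀ {X k k'} → Represents X k → Represents X k' → k ≡ k'
  represents-functional (w , X-spans) (w' , X-spans') =
    SameVertices⇒≡ w w' (X-spans' ⇔-∘ ⇔-sym X-spans)

sumTo-zero : ∀ d f → (∀ j → j ≤ d → f j ≡ + 0) → sumTo d f ≡ + 0
sumTo-zero zero    f vanish = vanish 0 z≤n
sumTo-zero (suc d) f vanish
  rewrite sumTo-zero d f (λ j j≤d → vanish j (ℕ.m≤n⇒m≤1+n j≤d)) | vanish (suc d) ℕ.≤-refl = refl

sumTo-last : ∀ d f → (∀ j → j < d → f j ≡ + 0) → sumTo d f ≡ f d
sumTo-last zero    f _      = refl
sumTo-last (suc d) f vanish rewrite sumTo-zero d f (λ j j≤d → vanish j (s≤s j≤d)) = ℤ.+-identityˡ (f (suc d))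

∸-suc : ∀ {j d} → j < d → d ∸ j ≡ suc (d ∸ suc j)
∸-suc {j} {suc d} (s≤s j≤d) = ℕ.+-∸-assoc 1 j≤d

-- The inner sum of _⊛_: (f ⊛ g) n d is the sum over i ≤ n of (f i ⊛ʸ g (n ∸ i)) d.
_⊛ʸ_ : (ℕ → ℤ) → (ℕ → ℤ) → ℕ → ℤ
(a ⊛ʸ b) d = sumTo d (λ j → a j ℤ.* b (d ∸ j))

-- multiplication by y
shiftʸ : (ℕ → ℤ) → ℕ → ℤ
shiftʸ a zero    = + 0
shiftʸ a (suc d) = a d

⊛ʸ-constant : ∀ a b d → (∀ j → b (suc j) ≡ + 0) → (a ⊛ʸ b) d ≡ a d ℤ.* b 0
⊛ʸ-constant a b d b-vanish =
  trans (sumTo-last d _ (λ j j<d → trans (cong (λ e → a j ℤ.* b e) (∸-suc j<d))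
                                          (trans (cong (a j ℤ.*_) (b-vanish _)) (ℤ.*-zeroʳ (a j)))))
        (cong (λ e → a d ℤ.* b e) (ℕ.n∸n≡0 d))

⊛ʸ-linear : ∀ a b d → b 0 ≡ + 0 → (∀ j → b (2 + j) ≡ + 0) → (a ⊛ʸ b) (suc d) ≡ a d ℤ.* b 1
⊛ʸ-linear a b d b₀ b-vanish = begin
  sumTo d (λ j → a j ℤ.* b (suc d ∸ j)) ℤ.+ a (suc d) ℤ.* b (d ∸ d)
    ≡⟨ cong (λ e → sumTo d (λ j → a j ℤ.* b (suc d ∸ j)) ℤ.+ e)
            (trans (cong (λ e → a (suc d) ℤ.* b e) (ℕ.n∸n≡0 d))
                   (trans (cong (a (suc d) ℤ.*_) b₀) (ℤ.*-zeroʳ (a (suc d))))) ⟩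
  sumTo d (λ j → a j ℤ.* b (suc d ∸ j)) ℤ.+ + 0
    ≡⟨ ℤ.+-identityʳ _ ⟩
  sumTo d (λ j → a j ℤ.* b (suc d ∸ j))
    ≡⟨ sumTo-last d _ vanish ⟩
  a d ℤ.* b (suc d ∸ d)
    ≡⟨ cong (λ e → a d ℤ.* b e) (ℕ.m+n∸n≡m 1 d) ⟩
  a d ℤ.* b 1
    ∎
  where
  open ≡-Reasoning
  vanish : ∀ j → j < d → a j ℤ.* b (suc d ∸ j) ≡ + 0
  vanish j j<d rewrite ℕ.+-∸-assoc 1 (ℕ.<⇒≤ j<d) | ∸-suc j<d = trans (cong (a j ℤ.*_) (b-vanish _)) (ℤ.*-zeroʳ (a j))

⊛ʸ-zero : ∀ a b d → (∀ j → b j ≡ + 0) → (a ⊛ʸ b) d ≡ + 0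
⊛ʸ-zero a b d b-vanish = sumTo-zero d _ (λ j _ → trans (cong (a j ℤ.*_) (b-vanish _)) (ℤ.*-zeroʳ (a j)))

*-1 : ∀ x → x ℤ.* ℤ.-1ℤ ≡ ℤ.- x
*-1 x = trans (ℤ.*-comm x ℤ.-1ℤ) (ℤ.-1*i≡-i x)

-- denom m is the coefficient of xᵐ, a polynomial in y.
⊛ʸ-denom₀ : ∀ a d → (a ⊛ʸ denom 0) d ≡ a d
⊛ʸ-denom₀ a d = trans (⊛ʸ-constant a (denom 0) d (λ _ → refl)) (ℤ.*-identityʳ (a d))

⊛ʸ-denom₁ : ∀ a d → (a ⊛ʸ denom 1) d ≡ ℤ.- a d
⊛ʸ-denom₁ a d = trans (⊛ʸ-constant a (denom 1) d (λ _ → refl)) (*-1 (a d))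

⊛ʸ-denom₂ : ∀ a d → (a ⊛ʸ denom 2) d ≡ ℤ.- a d
⊛ʸ-denom₂ a d = trans (⊛ʸ-constant a (denom 2) d (λ _ → refl)) (*-1 (a d))

⊛ʸ-denom₃ : ∀ a d → (a ⊛ʸ denom 3) d ≡ ℤ.- shiftʸ a d
⊛ʸ-denom₃ a zero    = ℤ.*-zeroʳ (a 0)
⊛ʸ-denom₃ a (suc d) = trans (⊛ʸ-linear a (denom 3) d refl (λ _ → refl)) (*-1 (a d))

⊛ʸ-denom₄₊ : ∀ a m d → (a ⊛ʸ denom (4 + m)) d ≡ + 0
⊛ʸ-denom₄₊ a m d = ⊛ʸ-zero a (denom (4 + m)) d (λ _ → refl)

⊛-denom₀ : ∀ f d → (f ⊛ denom) 0 d ≡ f 0 d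
⊛-denom₀ f d = ⊛ʸ-denom₀ (f 0) d

⊛-denom₁ : ∀ f d → (f ⊛ denom) 1 d ≡ ℤ.- f 0 d ℤ.+ f 1 d
⊛-denom₁ f d = cong₂ ℤ._+_ (⊛ʸ-denom₁ (f 0) d) (⊛ʸ-denom₀ (f 1) d)

⊛-denom₂ : ∀ f d → (f ⊛ denom) 2 d ≡ (ℤ.- f 0 d ℤ.+ ℤ.- f 1 d) ℤ.+ f 2 d
⊛-denom₂ f d = cong₂ ℤ._+_ (cong₂ ℤ._+_ (⊛ʸ-denom₂ (f 0) d) (⊛ʸ-denom₁ (f 1) d)) (⊛ʸ-denom₀ (f 2) d)

⊛-denom₃₊ : ∀ f m d → (f ⊛ denom) (3 + m) d ≡
            ((ℤ.- shiftʸ (f m) d ℤ.+ ℤ.- f (1 + m) d) ℤ.+ ℤ.- f (2 + m) d) ℤ.+ f (3 + m) d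
⊛-denom₃₊ f m d =
  cong₂ ℤ._+_ (cong₂ ℤ._+_ (cong₂ ℤ._+_ (trans (sumTo-last m term vanish) term-m) term-1+m) term-2+m) term-3+m
  where
  term : ℕ → ℤ
  term i = (f i ⊛ʸ denom (3 + m ∸ i)) d
  vanish : ∀ i → i < m → term i ≡ + 0
  vanish i i<m rewrite ℕ.+-∸-assoc 3 (ℕ.<⇒≤ i<m) | ∸-suc i<m = ⊛ʸ-denom₄₊ (f i) (m ∸ suc i) d
  term-m : term m ≡ ℤ.- shiftʸ (f m) d
  term-m rewrite ℕ.m+n∸n≡m 3 m = ⊛ʸ-denom₃ (f m) d
  term-1+m : term (1 + m) ≡ ℤ.- f (1 + m) d
  term-1+m rewrite ℕ.m+n∸n≡m 2 m = ⊛ʸ-denom₂ (f (1 + m)) d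
  term-2+m : term (2 + m) ≡ ℤ.- f (2 + m) d
  term-2+m rewrite ℕ.m+n∸n≡m 1 m = ⊛ʸ-denom₁ (f (2 + m)) d
  term-3+m : term (3 + m) ≡ f (3 + m) d
  term-3+m rewrite ℕ.n∸n≡0 m = ⊛ʸ-denom₀ (f (3 + m)) d

length-codes-suc : ∀ n d → length (codes (suc n) d) ≡
                   length (codes n d) + (length (codesᵛ n d) + (length (freeTails n d) + length (switchTails n d)))
length-codes-suc n d = begin
  length (map (H ∷_) A ++ map (V ∷_) B ++ map (F ∷_) C ++ map (C₁ ∷_) D)
    ≡⟨ length-++ (map (H ∷_) A) ⟩
  length (map (H ∷_) A) + length (map (V ∷_) B ++ map (F ∷_) C ++ map (C₁ ∷_) D)
    ≡⟨ cong₂ _+_ (length-map (H ∷_) A) (length-++ (map (V ∷_) B)) ⟩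
  length A + (length (map (V ∷_) B) + length (map (F ∷_) C ++ map (C₁ ∷_) D))
    ≡⟨ cong (λ e → length A + e) (cong₂ _+_ (length-map (V ∷_) B) (length-++ (map (F ∷_) C))) ⟩
  length A + (length B + (length (map (F ∷_) C) + length (map (C₁ ∷_) D)))
    ≡⟨ cong (λ e → length A + (length B + e)) (cong₂ _+_ (length-map (F ∷_) C) (length-map (C₁ ∷_) D)) ⟩
  length A + (length B + (length C + length D))
    ∎
  where
  open ≡-Reasoning
  A = codes n d
  B = codesᵛ n d
  C = freeTails n d
  D = switchTails n d

Sgf≡length-codes : ∀ n d → Sgf n d ≡ + length (codes n d)
Sgf≡length-codes n d = cong +_ (s≡length-codes n d)

length-switchTails : ∀ m d → + length (switchTails (2 + m) d) ≡ shiftʸ (Sgf m) d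
length-switchTails m zero    = refl
length-switchTails m (suc d) =
  trans (cong +_ (trans (length-map (C₂ ∷_) (codesᵛ (suc m) d)) (length-map (H ∷_) (codes m d))))
        (sym (Sgf≡length-codes m d))

-- a code of length n + 3 starts with H, with V H, or with C₁ C₂ H
Sgf-recurrence : ∀ m d → Sgf (3 + m) d ≡ Sgf (2 + m) d ℤ.+ (Sgf (1 + m) d ℤ.+ shiftʸ (Sgf m) d)
Sgf-recurrence m d = begin
  Sgf (3 + m) d
    ≡⟨ trans (Sgf≡length-codes (3 + m) d) (cong +_ (length-codes-suc (2 + m) d)) ⟩
  + (length (codes (2 + m) d) + (length (codesᵛ (2 + m) d) + length (switchTails (2 + m) d)))
    ≡⟨ ℤ.pos-+ (length (codes (2 + m) d)) _ ⟩
  + length (codes (2 + m) d) ℤ.+ + (length (codesᵛ (2 + m) d) + length (switchTails (2 + m) d))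
    ≡⟨ cong₂ ℤ._+_ (sym (Sgf≡length-codes (2 + m) d)) (ℤ.pos-+ (length (codesᵛ (2 + m) d)) _) ⟩
  Sgf (2 + m) d ℤ.+ (+ length (codesᵛ (2 + m) d) ℤ.+ + length (switchTails (2 + m) d))
    ≡⟨ cong (λ e → Sgf (2 + m) d ℤ.+ e)
         (cong₂ ℤ._+_ (trans (cong +_ (length-map (H ∷_) (codes (1 + m) d))) (sym (Sgf≡length-codes (1 + m) d)))
                      (length-switchTails m d)) ⟩
  Sgf (2 + m) d ℤ.+ (Sgf (1 + m) d ℤ.+ shiftʸ (Sgf m) d)
    ∎
  where open ≡-Reasoning

cancel₃ : ∀ a b c → ((ℤ.- c ℤ.+ ℤ.- b) ℤ.+ ℤ.- a) ℤ.+ (a ℤ.+ (b ℤ.+ c)) ≡ + 0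
cancel₃ = solve-∀

row₀ : ∀ d → (Sgf ⊛ denom) 0 d ≡ numer 0 d
row₀ d = trans (⊛-denom₀ Sgf d) (trans (Sgf≡length-codes 0 d) (counts d))
  where
  counts : ∀ d → + length (codes 0 d) ≡ numer 0 d
  counts zero    = refl
  counts (suc d) = refl

row₁ : ∀ d → (Sgf ⊛ denom) 1 d ≡ numer 1 d
row₁ d =
  trans (⊛-denom₁ Sgf d) (trans (cong₂ (λ a b → ℤ.- a ℤ.+ b) (Sgf≡length-codes 0 d) (Sgf≡length-codes 1 d)) (counts d))
  where
  counts : ∀ d → ℤ.- + length (codes 0 d) ℤ.+ + length (codes 1 d) ≡ numer 1 d
  counts zero          = refl
  counts (suc zero)    = refl
  counts (suc (suc d)) = refl

row₂ : ∀ d → (Sgf ⊛ denom) 2 d ≡ numer 2 d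
row₂ d =
  trans (⊛-denom₂ Sgf d)
    (trans (cong₂ ℤ._+_ (cong₂ (λ a b → ℤ.- a ℤ.+ ℤ.- b) (Sgf≡length-codes 0 d) (Sgf≡length-codes 1 d))
                        (Sgf≡length-codes 2 d))
           (counts d))
  where
  counts : ∀ d → (ℤ.- + length (codes 0 d) ℤ.+ ℤ.- + length (codes 1 d)) ℤ.+ + length (codes 2 d) ≡ numer 2 d
  counts zero          = refl
  counts (suc zero)    = refl
  counts (suc (suc d)) = refl

row₃₊ : ∀ m d → (Sgf ⊛ denom) (3 + m) d ≡ + 0
row₃₊ m d = begin
  (Sgf ⊛ denom) (3 + m) d                             ≡⟨ ⊛-denom₃₊ Sgf m d ⟩
  ((ℤ.- c ℤ.+ ℤ.- b) ℤ.+ ℤ.- a) ℤ.+ Sgf (3 + m) d     ≡⟨ cong (ℤ._+_ ((ℤ.- c ℤ.+ ℤ.- b) ℤ.+ ℤ.- a)) (Sgf-recurrence m d) ⟩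
  ((ℤ.- c ℤ.+ ℤ.- b) ℤ.+ ℤ.- a) ℤ.+ (a ℤ.+ (b ℤ.+ c)) ≡⟨ cancel₃ a b c ⟩
  + 0                                                 ∎
  where
  open ≡-Reasoning
  a = Sgf (2 + m) d
  b = Sgf (1 + m) d
  c = shiftʸ (Sgf m) d

proposition5p10 : (n d : ℕ) → (Sgf ⊛ denom) n d ≡ numer n d
proposition5p10 0                   = row₀
proposition5p10 1                   = row₁
proposition5p10 2                   = row₂
proposition5p10 (suc (suc (suc m))) = row₃₊ m
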